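{- Let $\star_0$ be a star of $\Gamma$ that is expressed as a minimal homogeneous linear combination, with nonzero coefficients in $\Bbbk$, of other stars $\star_1,\dots,\star_k$, none of which equals $\star_0$ or $-\star_0$. Then $\star_0$ is a star on two edges $\alpha\beta_1,\alpha\beta_2$, the vertices $\beta_1,\beta_2$ are joined by an edge, $k=2$, and either $\star_1=\pm\star_{\beta_1}(\alpha,\beta_2)$, $\star_2=\pm\star_{\beta_2}(\alpha,\beta_1)$, or the same with $\star_1,\star_2$ interchanged. Conversely, under these conditions such a linear dependence exists.
   Context: Let $\Bbbk$ be a field. For a finite simple graph $\Gamma$ with vertices $t_1,\dots,t_s$, $A=\Bbbk[t_1,\dots,t_s]$; each edge $\{t_i,t_j\}$ gives a degree-1 generator $e_{t_it_j}$; $K(\Gamma)$ is the exterior algebra over $A$ on them with $A$-linear graded-derivation differential $d(e_{t_it_j})=t_it_j$; $H(\Gamma)$ its homology, multigraded by monomials ($c\,m\,e_{i_1}\wedge\dots\wedge e_{i_k}$ has multidegree $m\,x_{i_1}\cdots x_{i_k}$, $x_i$ the edge monomial of $e_i$). For a vertex $x$ with distinct neighbours $y_1,\dots,y_k$ ($k\ge1$) the star is $\star_x(y_1,\dots,y_k)=[\tfrac1x d(e_{xy_1}\wedge\dots\wedge e_{xy_k})]$; it is homogeneous. A homogeneous linear combination is one of elements of the same multidegree. -}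

module Defs where

open import Level using (Level; _⊔_; suc)
open import Algebra.Bundles using (CommutativeRing)
open import Data.Nat as ℕ using (ℕ; zero; _<ᵇ_; _≤_)
open import Data.Fin as Fin using (Fin; toℕ)
open import Data.Vec as Vec using (Vec; lookup; tabulate; replicate; zipWith; _[_]≔_; _[_]%=_)
import Data.Vec.Properties as VecP
open import Data.Bool as Bool using (Bool; true; false; if_then_else_; _∧_)
open import Data.List as List using (List; []; _∷_; _++_; concatMap; filterᵇ; allFin; length; foldr)
open import Data.List.Relation.Unary.All using (All)
open import Data.List.Relation.Unary.Unique.Propositional using (Unique)
open import Data.Product using (Σ; ∃; ∃-syntax; _×_; _,_)
open import Data.Sum using (_⊎_)
open import Relation.Nullary using (¬_; does)
open import Relation.Binary.PropositionalEquality using (_≡_; _≢_)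

record Field (c ℓ : Level) : Set (suc (c ⊔ ℓ)) where
  field
    commutativeRing : CommutativeRing c ℓ
  open CommutativeRing commutativeRing public
  field
    0≉1     : ¬ (0# ≈ 1#)
    inverse : ∀ x → ¬ (x ≈ 0#) → ∃[ y ] (x * y ≈ 1#)

-- Finite simple graphs: vertices Fin s (the variables t_1..t_s),
-- edges Fin m, edge j joins src j and tgt j.

record Graph : Set where
  field
    s m      : ℕ
    src tgt  : Fin m → Fin s
    loopless : ∀ j → src j ≢ tgt j
    simple   : ∀ j j′ → ((src j ≡ src j′ × tgt j ≡ tgt j′) ⊎ (src j ≡ tgt j′ × tgt j ≡ src j′)) → j ≡ j′

-- The Koszul complex K(Γ) over A = 𝕜[t_1..t_s], written out on the
-- A-basis e_S (S a set of edges, wedge taken in increasing edge order)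
-- i.e. on the 𝕜-basis  μ · e_S  (μ a monomial = exponent vector).

module Koszul {c ℓ : Level} (F : Field c ℓ) (Γ : Graph) where
  open Field F
  open Graph Γ

  Mon : Set
  Mon = Vec ℕ s

  EdgeSet : Set
  EdgeSet = Vec Bool m

  Term : Set c
  Term = Carrier × Mon × EdgeSet

  -- elements of K(Γ) as finite formal sums of terms
  Elem : Set c
  Elem = List Term

  coeff : Elem → Mon → EdgeSet → Carrier
  coeff []                  ν T = 0#
  coeff ((a , μ , S) ∷ xs)  ν T =
    if does (VecP.≡-dec ℕ._≟_ μ ν) ∧ does (VecP.≡-dec Bool._≟_ S T)
    then a + coeff xs ν T else coeff xs ν T

  _≋_ : Elem → Elem → Set ℓ
  x ≋ y = ∀ ν T → coeff x ν T ≈ coeff y ν T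

  scale : Carrier → Elem → Elem
  scale a = List.map (λ { (b , μ , S) → (a * b , μ , S) })

  neg : Elem → Elem
  neg = scale (- 1#)

  sgn : ℕ → Carrier
  sgn zero       = 1#
  sgn (ℕ.suc n)  = - sgn n

  oneMon : Mon
  oneMon = replicate s 0

  varMon : Fin s → Mon
  varMon v = tabulate (λ w → if does (v Fin.≟ w) then 1 else 0)

  _·_ : Mon → Mon → Mon
  _·_ = zipWith ℕ._+_

  edgeMon : Fin m → Mon
  edgeMon j = varMon (src j) · varMon (tgt j)

  below : EdgeSet → Fin m → ℕ
  below S j = length (filterᵇ (λ i → lookup S i ∧ (toℕ i <ᵇ toℕ j)) (allFin m))

  dTerm : Term → Elem
  dTerm (a , μ , S) =
    List.map (λ j → (sgn (below S j) * a , μ · edgeMon j , S [ j ]≔ false))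
             (filterᵇ (lookup S) (allFin m))

  d : Elem → Elem
  d = concatMap dTerm

  wedgeTerm : Fin m → Term → Elem
  wedgeTerm j (a , μ , S) =
    if lookup S j then [] else (sgn (below S j) * a , μ , S [ j ]≔ true) ∷ []

  wedgeL : Fin m → Elem → Elem
  wedgeL j = concatMap (wedgeTerm j)

  wedgeList : List (Fin m) → Elem
  wedgeList []       = (1# , oneMon , replicate m false) ∷ []
  wedgeList (j ∷ js) = wedgeL j (wedgeList js)

  divVar : Fin s → Elem → Elem
  divVar v = List.map (λ { (a , μ , S) → (a , μ [ v ]%= ℕ.pred , S) })

  HEq : Elem → Elem → Set (c ⊔ ℓ)
  HEq z z′ = Σ Elem (λ w → (z ++ neg z′) ≋ d w)

  HEq± : Elem → Elem → Set (c ⊔ ℓ)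
  HEq± z z′ = HEq z z′ ⊎ HEq z (neg z′)

  Joins : Fin m → Fin s → Fin s → Set
  Joins j a b = (src j ≡ a × tgt j ≡ b) ⊎ (src j ≡ b × tgt j ≡ a)

  -- representative (1/x) d(e_{j₁} ∧ ⋯ ∧ e_{j_k}) of the star at x
  starRep : Fin s → List (Fin m) → Elem
  starRep x js = divVar x (d (wedgeList js))

  record Star : Set where
    field
      center   : Fin s
      edges    : List (Fin m)
      nonempty : edges ≢ []
      incident : All (λ j → src j ≡ center ⊎ tgt j ≡ center) edges
      distinct : Unique edges

  rep : Star → Elem
  rep σ = starRep (Star.center σ) (Star.edges σ)

  termDeg : Mon → EdgeSet → Mon
  termDeg μ S = foldr (λ j ν → if lookup S j then ν · edgeMon j else ν) μ (allFin m)

  HasDeg : Elem → Mon → Set ℓ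
  HasDeg z D = ∀ μ S → ¬ (coeff z μ S ≈ 0#) → termDeg μ S ≡ D

  lincomb : (k : ℕ) → (Fin k → Carrier) → (Fin k → Star) → Elem
  lincomb k b σ = concatMap (λ i → scale (b i) (rep (σ i))) (allFin k)

  MinDep : Star → (k : ℕ) → (Fin k → Star) → (Fin k → Carrier) → Set (c ⊔ ℓ)
  MinDep σ₀ k σ cf =
    (1 ≤ k)
    × (∀ i → ¬ HEq (rep (σ i)) (rep σ₀) × ¬ HEq (rep (σ i)) (neg (rep σ₀)))
    × (∃[ D ] (HasDeg (rep σ₀) D × (∀ i → HasDeg (rep (σ i)) D)))
    × (∀ i → ¬ (cf i ≈ 0#))
    × HEq (rep σ₀) (lincomb k cf σ)
    -- minimality: no combination using a proper subfamily expresses ⋆₀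
    × (∀ (b : Fin k → Carrier) → (∃[ i ] (b i ≈ 0#)) → ¬ HEq (rep σ₀) (lincomb k b σ))

  Shape : Star → (k : ℕ) → (Fin k → Star) → Set (c ⊔ ℓ)
  Shape σ₀ k σ =
    (k ≡ 2)
    × ∃[ α ] ∃[ β₁ ] ∃[ β₂ ] ∃[ j₁ ] ∃[ j₂ ] ∃[ j₃ ]
        ( Joins j₁ α β₁ × Joins j₂ α β₂ × Joins j₃ β₁ β₂
        × Star.center σ₀ ≡ α × Star.edges σ₀ ≡ j₁ ∷ j₂ ∷ []
        × ∃[ i₁ ] ∃[ i₂ ]
            ( i₁ ≢ i₂
            × HEq± (rep (σ i₁)) (starRep β₁ (j₁ ∷ j₃ ∷ []))
            × HEq± (rep (σ i₂)) (starRep β₂ (j₂ ∷ j₃ ∷ []))))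

module Submission where

-- A star ⋆_x(y₁,…,y_k) is represented by Σᵢ ± t_{yᵢ} e_{S∖jᵢ}: all its terms sit at linear
-- monomials t_y, whereas every term of a boundary d w is divisible by an edge monomial. So homology
-- relations among stars are coefficientwise identities, and two stars with the same centre and the
-- same multidegree x^{k-1} y₁⋯y_k agree up to sign. Let D be the multidegree of ⋆₀ = ⋆_x(…). A star
-- of degree D centred elsewhere has exponent ≤ 1 at x, which excludes three or more edges; for one
-- edge, D = t_y and all one-edge stars ending at y coincide up to sign. For ⋆₀ = ⋆_α(β₁,β₂) the
-- other stars of degree t_α t_{β₁} t_{β₂} are centred at β₁ or β₂, each centre is needed (a star
-- never involves its own centre variable, while ⋆₀ involves both t_{β₁} and t_{β₂}), which forces
-- the edge β₁β₂, and all stars at one centre are proportional, so minimality leaves one of each.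
-- Conversely the two-edge stars of a triangle satisfy ⋆_α(β₁,β₂) = ±⋆_{β₁}(α,β₂) ± ⋆_{β₂}(α,β₁).

open import Algebra.Bundles using (CommutativeMonoid; CommutativeRing)
open import Data.Bool as Bool using (Bool; true; false; if_then_else_; _∧_)
open import Data.Empty using (⊥; ⊥-elim)
open import Data.Fin as Fin using (Fin; zero; suc; punchIn; punchOut)
import Data.Fin.Properties as FinP
open import Data.Fin.Properties using (punchInᵢ≢i; punchIn-injective; punchIn-punchOut; toℕ-injective)
open import Data.List as List using (List; []; _∷_; _++_)
open import Data.List.Membership.Propositional using (_∈_; _∉_)
import Data.List.Properties as ListP
open import Data.List.Relation.Unary.All as All using (All)
open import Data.List.Relation.Unary.All.Properties using (All¬⇒¬Any)
import Data.List.Relation.Unary.AllPairs as AP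
open import Data.List.Relation.Unary.Any using (here; there)
open import Data.List.Relation.Unary.Unique.Propositional using (Unique)
open import Data.Nat as ℕ using (ℕ; zero; suc)
import Data.Nat.Properties as NP
open import Data.Nat.Tactic.RingSolver using (solve-∀)
open import Data.Product using (∃-syntax; _×_; _,_; proj₁; proj₂)
open import Data.Sum as Sum using (_⊎_; inj₁; inj₂; [_,_]′)
open import Data.Vec as Vec using (Vec; lookup)
import Data.Vec.Properties as VecP
open import Data.Vec.Functional using (Vector; removeAt)
open import Data.Vec.Relation.Binary.Pointwise.Extensional using (ext; Pointwise-≡⇒≡)
open import Function using (_∘_)
open import Level using (Level)
open import Relation.Binary.PropositionalEquality as ≡ using (_≡_; _≢_)
open import Relation.Nullary using (¬_; Dec; yes; no; does)
open import Relation.Nullary.Decidable using (_×-dec_)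

open import Defs

module FiniteSums {a ℓ} (M : CommutativeMonoid a ℓ) where
  open CommutativeMonoid M
    renaming (_∙_ to _+_; ε to 0#; ∙-cong to +-cong; ∙-congˡ to +-congˡ; ∙-congʳ to +-congʳ;
              identityˡ to +-identityˡ; identityʳ to +-identityʳ; assoc to +-assoc; comm to +-comm)
  open import Algebra.Properties.CommutativeMonoid.Sum M public using (sum; sum-remove; sum-cong-≋; ∑-distrib-+)
  open import Relation.Binary.Reasoning.Setoid setoid

  sum-zero : ∀ {n} {f : Vector Carrier n} → (∀ i → f i ≈ 0#) → sum f ≈ 0#
  sum-zero {zero}  f≈0 = refl
  sum-zero {suc n} f≈0 = trans (+-cong (f≈0 zero) (sum-zero (f≈0 ∘ suc))) (+-identityˡ 0#)

  sum-single : ∀ {n} {f : Vector Carrier n} i → (∀ j → j ≢ i → f j ≈ 0#) → sum f ≈ f i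
  sum-single {suc n} {f} i others≈0 = begin
    sum f                        ≈⟨ sum-remove f ⟩
    f i + sum (removeAt f i)     ≈⟨ +-congˡ (sum-zero (λ j → others≈0 (punchIn i j) (punchInᵢ≢i i j))) ⟩
    f i + 0#                     ≈⟨ +-identityʳ (f i) ⟩
    f i                          ∎

  sum-pair : ∀ {n} {f : Vector Carrier n} i j → i ≢ j →
             (∀ k → k ≢ i → k ≢ j → f k ≈ 0#) → sum f ≈ f i + f j
  sum-pair {suc n} {f} i j i≢j others≈0 = begin
    sum f                                 ≈⟨ sum-remove f ⟩
    f i + sum (removeAt f i)              ≈⟨ +-congˡ (sum-single (punchOut i≢j) rest≈0) ⟩
    f i + f (punchIn i (punchOut i≢j))    ≡⟨ ≡.cong (λ k → f i + f k) (punchIn-punchOut i≢j) ⟩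
    f i + f j                             ∎
    where
    rest≈0 : ∀ k → k ≢ punchOut i≢j → f (punchIn i k) ≈ 0#
    rest≈0 k k≢ = others≈0 (punchIn i k) (punchInᵢ≢i i k)
      (λ eq → k≢ (punchIn-injective i k _ (≡.trans eq (≡.sym (punchIn-punchOut i≢j)))))

  sum-swap-at : ∀ {n} {f g : Vector Carrier n} i → (∀ j → j ≢ i → f j ≈ g j) →
                sum f + g i ≈ sum g + f i
  sum-swap-at {suc n} {f} {g} i f≈g = begin
    sum f + g i                         ≈⟨ +-congʳ (sum-remove f) ⟩
    (f i + sum (removeAt f i)) + g i    ≈⟨ +-assoc (f i) _ (g i) ⟩
    f i + (sum (removeAt f i) + g i)    ≈⟨ +-comm (f i) _ ⟩
    (sum (removeAt f i) + g i) + f i    ≈⟨ +-congʳ (+-comm _ (g i)) ⟩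
    (g i + sum (removeAt f i)) + f i    ≈⟨ +-congʳ (+-congˡ (sum-cong-≋ (λ j → f≈g (punchIn i j) (punchInᵢ≢i i j)))) ⟩
    (g i + sum (removeAt g i)) + f i    ≈⟨ +-congʳ (sym (sum-remove g)) ⟩
    sum g + f i                         ∎

module Signs {c ℓ} (R : CommutativeRing c ℓ) where
  open CommutativeRing R
  open import Algebra.Properties.Ring ring using (-1*x≈-x; -‿involutive; -0#≈0#)
  open import Relation.Binary.Reasoning.Setoid setoid

  IsSign : Carrier → Set ℓ
  IsSign u = u ≈ 1# ⊎ u ≈ - 1#

  -1*-1≈1 : - 1# * - 1# ≈ 1#
  -1*-1≈1 = trans (-1*x≈-x (- 1#)) (-‿involutive 1#)

  isSign-* : ∀ {u v} → IsSign u → IsSign v → IsSign (u * v)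
  isSign-* (inj₁ u≈1) (inj₁ v≈1) = inj₁ (trans (*-cong u≈1 v≈1) (*-identityˡ 1#))
  isSign-* (inj₁ u≈1) (inj₂ v≈-1) = inj₂ (trans (*-cong u≈1 v≈-1) (*-identityˡ (- 1#)))
  isSign-* (inj₂ u≈-1) (inj₁ v≈1) = inj₂ (trans (*-cong u≈-1 v≈1) (*-identityʳ (- 1#)))
  isSign-* (inj₂ u≈-1) (inj₂ v≈-1) = inj₁ (trans (*-cong u≈-1 v≈-1) -1*-1≈1)

  isSign-square : ∀ {u} → IsSign u → u * u ≈ 1#
  isSign-square (inj₁ u≈1) = trans (*-cong u≈1 u≈1) (*-identityˡ 1#)
  isSign-square (inj₂ u≈-1) = trans (*-cong u≈-1 u≈-1) -1*-1≈1

  isSign-neg : ∀ {u} → IsSign u → IsSign (- u)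
  isSign-neg (inj₁ u≈1) = inj₂ (-‿cong u≈1)
  isSign-neg (inj₂ u≈-1) = inj₁ (trans (-‿cong u≈-1) (-‿involutive 1#))

  isSign⇒≉0 : ¬ (0# ≈ 1#) → ∀ {u} → IsSign u → ¬ (u ≈ 0#)
  isSign⇒≉0 0≉1 (inj₁ u≈1) u≈0 = 0≉1 (trans (sym u≈0) u≈1)
  isSign⇒≉0 0≉1 (inj₂ u≈-1) u≈0 =
    0≉1 (sym (trans (sym (-‿involutive 1#)) (trans (-‿cong (trans (sym u≈-1) u≈0)) -0#≈0#)))

  sign-cancelʳ : ∀ {u} x → IsSign u → (x * u) * u ≈ x
  sign-cancelʳ {u} x ±u = trans (*-assoc x u u) (trans (*-congˡ (isSign-square ±u)) (*-identityʳ x))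

  sign-cancelˡ : ∀ {u} x → IsSign u → u * (u * x) ≈ x
  sign-cancelˡ {u} x ±u = trans (sym (*-assoc u u x)) (trans (*-congʳ (isSign-square ±u)) (*-identityˡ x))

  sign-cancel-middle : ∀ {u} x y → IsSign u → (x * u) * (u * y) ≈ x * y
  sign-cancel-middle {u} x y ±u = trans (*-assoc x u (u * y)) (*-congˡ (sign-cancelˡ y ±u))

  sign-product≈-1⇒≈- : ∀ {a b} → IsSign b → a * b ≈ - 1# → a ≈ - b
  sign-product≈-1⇒≈- {a} {b} ±b ab≈-1 = begin
    a                ≈⟨ sign-cancelʳ a ±b ⟨
    (a * b) * b      ≈⟨ *-congʳ ab≈-1 ⟩
    - 1# * b         ≈⟨ -1*x≈-x b ⟩
    - b              ∎

  triangle-relation : ∀ {s₀₁ s₀₂ s₁₁ s₁₃ s₂₂ s₂₃} X Y Z → IsSign s₀₂ → IsSign s₁₃ → IsSign s₂₃ →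
    s₀₁ * s₀₂ ≈ - 1# → s₁₁ * s₁₃ ≈ - 1# → s₂₂ * s₂₃ ≈ - 1# →
    s₀₁ * X + s₀₂ * Y ≈ (s₀₂ * s₁₃) * (s₁₁ * Z + s₁₃ * Y) + (s₀₁ * s₂₃) * (s₂₂ * Z + s₂₃ * X)
  triangle-relation {s₀₁} {s₀₂} {s₁₁} {s₁₃} {s₂₂} {s₂₃} X Y Z ±s₀₂ ±s₁₃ ±s₂₃ s₀≈-1 s₁≈-1 s₂≈-1 = sym (begin
    (s₀₂ * s₁₃) * (s₁₁ * Z + s₁₃ * Y) + (s₀₁ * s₂₃) * (s₂₂ * Z + s₂₃ * X)
      ≈⟨ expand s₀₁ s₀₂ s₁₁ s₁₃ s₂₂ s₂₃ X Y Z ⟩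
    (s₀₂ * (s₁₁ * s₁₃) * Z + s₀₂ * (s₁₃ * s₁₃) * Y) + (s₀₁ * (s₂₂ * s₂₃) * Z + s₀₁ * (s₂₃ * s₂₃) * X)
      ≈⟨ +-cong (+-cong (*-congʳ (*-congˡ s₁≈-1)) (*-congʳ (trans (*-congˡ (isSign-square ±s₁₃)) (*-identityʳ s₀₂))))
                (+-cong (*-congʳ (*-congˡ s₂≈-1)) (*-congʳ (trans (*-congˡ (isSign-square ±s₂₃)) (*-identityʳ s₀₁)))) ⟩
    (s₀₂ * - 1# * Z + s₀₂ * Y) + (s₀₁ * - 1# * Z + s₀₁ * X)
      ≈⟨ collect s₀₁ s₀₂ (- 1#) X Y Z ⟩
    (s₀₁ * X + s₀₂ * Y) + (s₀₁ + s₀₂) * (- 1# * Z)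
      ≈⟨ +-congˡ (trans (*-congʳ s₀₁+s₀₂≈0) (zeroˡ _)) ⟩
    (s₀₁ * X + s₀₂ * Y) + 0#
      ≈⟨ +-identityʳ _ ⟩
    s₀₁ * X + s₀₂ * Y ∎)
    where
    open import Algebra.Solver.Ring.NaturalCoefficients.Default commutativeSemiring
    s₀₁+s₀₂≈0 : s₀₁ + s₀₂ ≈ 0#
    s₀₁+s₀₂≈0 = trans (+-congʳ (sign-product≈-1⇒≈- ±s₀₂ s₀≈-1)) (-‿inverseˡ s₀₂)
    expand : ∀ a b c d e f X Y Z →
      (b * d) * (c * Z + d * Y) + (a * f) * (e * Z + f * X)
        ≈ (b * (c * d) * Z + b * (d * d) * Y) + (a * (e * f) * Z + a * (f * f) * X)
    expand = solve 9 (λ a b c d e f X Y Z →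
      (b :* d) :* (c :* Z :+ d :* Y) :+ (a :* f) :* (e :* Z :+ f :* X) :=
      (b :* (c :* d) :* Z :+ b :* (d :* d) :* Y) :+ (a :* (e :* f) :* Z :+ a :* (f :* f) :* X)) refl
    collect : ∀ a b n X Y Z → (b * n * Z + b * Y) + (a * n * Z + a * X) ≈ (a * X + b * Y) + (a + b) * (n * Z)
    collect = solve 6 (λ a b n X Y Z →
      (b :* n :* Z :+ b :* Y) :+ (a :* n :* Z :+ a :* X) := (a :* X :+ b :* Y) :+ (a :+ b) :* (n :* Z)) refl

Fin2-cover : ∀ (a b : Fin 2) → a ≢ b → ∀ i → i ≡ a ⊎ i ≡ b
Fin2-cover zero       zero       a≢b _          = ⊥-elim (a≢b ≡.refl)
Fin2-cover zero       (suc zero) _   zero       = inj₁ ≡.refl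
Fin2-cover zero       (suc zero) _   (suc zero) = inj₂ ≡.refl
Fin2-cover (suc zero) zero       _   zero       = inj₂ ≡.refl
Fin2-cover (suc zero) zero       _   (suc zero) = inj₁ ≡.refl
Fin2-cover (suc zero) (suc zero) a≢b _          = ⊥-elim (a≢b ≡.refl)

coveredByTwo⇒≡2 : ∀ {n} (a b : Fin n) → a ≢ b → (∀ c → c ≢ a → c ≢ b → ⊥) → n ≡ 2
coveredByTwo⇒≡2 {1}             zero zero a≢b _ = ⊥-elim (a≢b ≡.refl)
coveredByTwo⇒≡2 {2}             _    _    _   _ = ≡.refl
coveredByTwo⇒≡2 {suc (suc (suc n))} a b _ covered with zero Fin.≟ a | zero Fin.≟ b
... | no 0≢a | no 0≢b = ⊥-elim (covered zero 0≢a 0≢b)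
... | yes ≡.refl | _ with suc zero Fin.≟ b
...   | no 1≢b     = ⊥-elim (covered (suc zero) (λ ()) 1≢b)
...   | yes ≡.refl = ⊥-elim (covered (suc (suc zero)) (λ ()) (λ ()))
coveredByTwo⇒≡2 {suc (suc (suc n))} a b _ covered | no _ | yes ≡.refl with suc zero Fin.≟ a
...   | no 1≢a     = ⊥-elim (covered (suc zero) 1≢a (λ ()))
...   | yes ≡.refl = ⊥-elim (covered (suc (suc zero)) (λ ()) (λ ()))

lookup-ext : ∀ {A : Set} {n} {xs ys : Vec A n} → (∀ i → lookup xs i ≡ lookup ys i) → xs ≡ ys
lookup-ext = Pointwise-≡⇒≡ ∘ ext

module Combinatorics {c ℓ} (F : Field c ℓ) (Γ : Graph) where
  open Graph Γ
  open Koszul F Γ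
  open ≡.≡-Reasoning
  module ℕΣ = FiniteSums NP.+-0-commutativeMonoid
  open import Data.List.Membership.DecPropositional (Fin._≟_ {m}) using (_∈?_)

  δ : Fin s → Fin s → ℕ
  δ y v = if does (y Fin.≟ v) then 1 else 0

  δ-refl : ∀ v → δ v v ≡ 1
  δ-refl v with v Fin.≟ v
  ... | yes _   = ≡.refl
  ... | no v≢v  = ⊥-elim (v≢v ≡.refl)

  δ-≢ : ∀ {y v} → y ≢ v → δ y v ≡ 0
  δ-≢ {y} {v} y≢v with y Fin.≟ v
  ... | yes y≡v = ⊥-elim (y≢v y≡v)
  ... | no _    = ≡.refl

  δ-pos⇒≡ : ∀ {y v} → 1 ℕ.≤ δ y v → y ≡ v
  δ-pos⇒≡ {y} {v} 1≤δ with y Fin.≟ v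
  δ-pos⇒≡ 1≤δ  | yes y≡v = y≡v
  δ-pos⇒≡ ()   | no _

  lookup-varMon : ∀ y v → lookup (varMon y) v ≡ δ y v
  lookup-varMon y v = VecP.lookup∘tabulate _ v

  lookup-· : ∀ (μ ν : Mon) v → lookup (μ · ν) v ≡ lookup μ v ℕ.+ lookup ν v
  lookup-· μ ν v = VecP.lookup-zipWith ℕ._+_ v μ ν

  varMon-injective : ∀ {y z} → varMon y ≡ varMon z → y ≡ z
  varMon-injective {y} {z} eq = δ-pos⇒≡ (NP.≤-reflexive (≡.sym δyz≡1))
    where
    δyz≡1 : δ y z ≡ 1
    δyz≡1 = begin
      δ y z                ≡⟨ lookup-varMon y z ⟨
      lookup (varMon y) z  ≡⟨ ≡.cong (λ μ → lookup μ z) eq ⟩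
      lookup (varMon z) z  ≡⟨ lookup-varMon z z ⟩
      δ z z                ≡⟨ δ-refl z ⟩
      1                    ∎

  Incident : Fin m → Fin s → Set
  Incident j x = src j ≡ x ⊎ tgt j ≡ x

  AllIncident : Fin s → List (Fin m) → Set
  AllIncident x = All (λ j → Incident j x)

  opposite : Fin s → Fin m → Fin s
  opposite x j = if does (src j Fin.≟ x) then tgt j else src j

  joins-sym : ∀ {j a b} → Joins j a b → Joins j b a
  joins-sym (inj₁ ends) = inj₂ ends
  joins-sym (inj₂ ends) = inj₁ ends

  joins⇒≢ : ∀ {j a b} → Joins j a b → a ≢ b
  joins⇒≢ {j} (inj₁ (src≡a , tgt≡b)) a≡b = loopless j (≡.trans src≡a (≡.trans a≡b (≡.sym tgt≡b)))
  joins⇒≢ {j} (inj₂ (src≡b , tgt≡a)) a≡b = loopless j (≡.trans src≡b (≡.trans (≡.sym a≡b) (≡.sym tgt≡a)))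

  joins⇒incident : ∀ {j a b} → Joins j a b → Incident j a
  joins⇒incident (inj₁ (src≡a , _)) = inj₁ src≡a
  joins⇒incident (inj₂ (_ , tgt≡a)) = inj₂ tgt≡a

  joins-unique : ∀ {j j′ a b} → Joins j a b → Joins j′ a b → j ≡ j′
  joins-unique {j} {j′} (inj₁ (p , q)) (inj₁ (p′ , q′)) = simple j j′ (inj₁ (≡.trans p (≡.sym p′) , ≡.trans q (≡.sym q′)))
  joins-unique {j} {j′} (inj₁ (p , q)) (inj₂ (p′ , q′)) = simple j j′ (inj₂ (≡.trans p (≡.sym q′) , ≡.trans q (≡.sym p′)))
  joins-unique {j} {j′} (inj₂ (p , q)) (inj₁ (p′ , q′)) = simple j j′ (inj₂ (≡.trans p (≡.sym q′) , ≡.trans q (≡.sym p′)))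
  joins-unique {j} {j′} (inj₂ (p , q)) (inj₂ (p′ , q′)) = simple j j′ (inj₁ (≡.trans p (≡.sym p′) , ≡.trans q (≡.sym q′)))

  incident⇒joins : ∀ {j x} → Incident j x → Joins j x (opposite x j)
  incident⇒joins {j} {x} inc with src j Fin.≟ x
  ... | yes src≡x = inj₁ (src≡x , ≡.refl)
  incident⇒joins (inj₁ src≡x) | no src≢x = ⊥-elim (src≢x src≡x)
  incident⇒joins (inj₂ tgt≡x) | no _     = inj₂ (≡.refl , tgt≡x)

  opposite-joins : ∀ {j x y} → Joins j x y → opposite x j ≡ y
  opposite-joins {j} {x} J = joins-unique-end (incident⇒joins (joins⇒incident J)) J
    where
    joins-unique-end : ∀ {y y′} → Joins j x y → Joins j x y′ → y ≡ y′
    joins-unique-end (inj₁ (_ , q)) (inj₁ (_ , q′)) = ≡.trans (≡.sym q) q′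
    joins-unique-end (inj₂ (p , _)) (inj₂ (p′ , _)) = ≡.trans (≡.sym p) p′
    joins-unique-end (inj₁ (p , q)) (inj₂ (p′ , q′)) = ⊥-elim (loopless j (≡.trans p (≡.sym q′)))
    joins-unique-end (inj₂ (p , q)) (inj₁ (p′ , q′)) = ⊥-elim (loopless j (≡.trans p′ (≡.sym q)))

  opposite≢ : ∀ {j x} → Incident j x → opposite x j ≢ x
  opposite≢ inc eq = joins⇒≢ (incident⇒joins inc) (≡.sym eq)

  edgeExp : Fin m → Fin s → ℕ
  edgeExp j v = lookup (edgeMon j) v

  edgeExp-joins : ∀ {j a b} → Joins j a b → ∀ v → edgeExp j v ≡ δ a v ℕ.+ δ b v
  edgeExp-joins {j} J v = ≡.trans (lookup-· (varMon (src j)) (varMon (tgt j)) v) (ends J)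
    where
    ends : ∀ {a b} → Joins j a b → lookup (varMon (src j)) v ℕ.+ lookup (varMon (tgt j)) v ≡ δ a v ℕ.+ δ b v
    ends (inj₁ (≡.refl , ≡.refl)) = ≡.cong₂ ℕ._+_ (lookup-varMon (src j) v) (lookup-varMon (tgt j) v)
    ends (inj₂ (≡.refl , ≡.refl)) = ≡.trans (≡.cong₂ ℕ._+_ (lookup-varMon (src j) v) (lookup-varMon (tgt j) v))
                                           (NP.+-comm (δ (src j) v) (δ (tgt j) v))

  edgeExp-incident : ∀ {j x} → Incident j x → ∀ v → edgeExp j v ≡ δ x v ℕ.+ δ (opposite x j) v
  edgeExp-incident inc = edgeExp-joins (incident⇒joins inc)

  ·edgeMon≢varMon : ∀ μ j y → μ · edgeMon j ≢ varMon y
  ·edgeMon≢varMon μ j y eq = loopless j (≡.trans (≡.sym (atY (src j) atSrc)) (atY (tgt j) atTgt))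
    where
    atY : ∀ v → 1 ℕ.≤ lookup (μ · edgeMon j) v → y ≡ v
    atY v pos = δ-pos⇒≡ (≡.subst (1 ℕ.≤_) (≡.trans (≡.cong (λ ν → lookup ν v) eq) (lookup-varMon y v)) pos)
    lookup-μ·edge : ∀ v → lookup (μ · edgeMon j) v ≡ lookup μ v ℕ.+ (δ (src j) v ℕ.+ δ (tgt j) v)
    lookup-μ·edge v = ≡.trans (lookup-· μ (edgeMon j) v) (≡.cong (lookup μ v ℕ.+_) (edgeExp-joins (inj₁ (≡.refl , ≡.refl)) v))
    atSrc : 1 ℕ.≤ lookup (μ · edgeMon j) (src j)
    atSrc rewrite lookup-μ·edge (src j) | δ-refl (src j) = NP.≤-trans (NP.m≤m+n 1 (δ (tgt j) (src j))) (NP.m≤n+m _ (lookup μ (src j)))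
    atTgt : 1 ℕ.≤ lookup (μ · edgeMon j) (tgt j)
    atTgt rewrite lookup-μ·edge (tgt j) | δ-refl (tgt j) =
      NP.≤-trans (NP.m≤n+m 1 (δ (src j) (tgt j))) (NP.m≤n+m _ (lookup μ (tgt j)))

  -- x_j / t_x, in the form in which divVar produces it
  cofactor : Fin s → Fin m → Mon
  cofactor x j = (oneMon · edgeMon j) Vec.[ x ]%= ℕ.pred

  cofactor-incident : ∀ {j x} → Incident j x → cofactor x j ≡ varMon (opposite x j)
  cofactor-incident {j} {x} inc = lookup-ext pointwise
    where
    y = opposite x j
    lookup-oneMon·edge : ∀ v → lookup (oneMon · edgeMon j) v ≡ δ x v ℕ.+ δ y v
    lookup-oneMon·edge v = begin
      lookup (oneMon · edgeMon j) v   ≡⟨ lookup-· oneMon (edgeMon j) v ⟩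
      lookup oneMon v ℕ.+ edgeExp j v ≡⟨ ≡.cong (ℕ._+ edgeExp j v) (VecP.lookup-replicate v 0) ⟩
      edgeExp j v                     ≡⟨ edgeExp-incident inc v ⟩
      δ x v ℕ.+ δ y v                 ∎
    pointwise : ∀ v → lookup (cofactor x j) v ≡ lookup (varMon y) v
    pointwise v with x Fin.≟ v
    ... | yes ≡.refl = begin
      lookup (cofactor x j) x                  ≡⟨ VecP.lookup∘updateAt x (oneMon · edgeMon j) ⟩
      ℕ.pred (lookup (oneMon · edgeMon j) x)  ≡⟨ ≡.cong ℕ.pred (lookup-oneMon·edge x) ⟩
      ℕ.pred (δ x x ℕ.+ δ y x)                ≡⟨ ≡.cong (λ n → ℕ.pred (n ℕ.+ δ y x)) (δ-refl x) ⟩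
      δ y x                                   ≡⟨ lookup-varMon y x ⟨
      lookup (varMon y) x                     ∎
    ... | no x≢v = begin
      lookup (cofactor x j) v           ≡⟨ VecP.lookup∘updateAt′ v x (x≢v ∘ ≡.sym) (oneMon · edgeMon j) ⟩
      lookup (oneMon · edgeMon j) v    ≡⟨ lookup-oneMon·edge v ⟩
      δ x v ℕ.+ δ y v                  ≡⟨ ≡.cong (ℕ._+ δ y v) (δ-≢ x≢v) ⟩
      δ y v                            ≡⟨ lookup-varMon y v ⟨
      lookup (varMon y) v              ∎

  edgeSet : List (Fin m) → EdgeSet
  edgeSet []       = Vec.replicate m false
  edgeSet (j ∷ js) = edgeSet js Vec.[ j ]≔ true

  edgeSet-∈ : ∀ {j} js → j ∈ js → lookup (edgeSet js) j ≡ true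
  edgeSet-∈ (h ∷ t) (here ≡.refl) = VecP.lookup∘update h (edgeSet t) true
  edgeSet-∈ {j} (h ∷ t) (there j∈t) with h Fin.≟ j
  ... | yes ≡.refl = VecP.lookup∘update h (edgeSet t) true
  ... | no h≢j     = ≡.trans (VecP.lookup∘update′ (h≢j ∘ ≡.sym) (edgeSet t) true) (edgeSet-∈ t j∈t)

  edgeSet-∉ : ∀ {j} js → j ∉ js → lookup (edgeSet js) j ≡ false
  edgeSet-∉ {j} []      _   = VecP.lookup-replicate j false
  edgeSet-∉ {j} (h ∷ t) j∉ with h Fin.≟ j
  ... | yes ≡.refl = ⊥-elim (j∉ (here ≡.refl))
  ... | no h≢j     = ≡.trans (VecP.lookup∘update′ (h≢j ∘ ≡.sym) (edgeSet t) true) (edgeSet-∉ t (j∉ ∘ there))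

  edgeSet-true⇒∈ : ∀ {j} js → lookup (edgeSet js) j ≡ true → j ∈ js
  edgeSet-true⇒∈ {j} js eq with j ∈? js
  ... | yes j∈ = j∈
  ... | no j∉ with ≡.trans (≡.sym eq) (edgeSet-∉ js j∉)
  ...   | ()

  edgeSet-ext : ∀ js js′ → (∀ {j} → j ∈ js → j ∈ js′) → (∀ {j} → j ∈ js′ → j ∈ js) → edgeSet js ≡ edgeSet js′
  edgeSet-ext js js′ ⊆ ⊇ = lookup-ext pointwise
    where
    pointwise : ∀ j → lookup (edgeSet js) j ≡ lookup (edgeSet js′) j
    pointwise j with j ∈? js
    ... | yes j∈ = ≡.trans (edgeSet-∈ js j∈) (≡.sym (edgeSet-∈ js′ (⊆ j∈)))
    ... | no j∉  = ≡.trans (edgeSet-∉ js j∉) (≡.sym (edgeSet-∉ js′ (j∉ ∘ ⊇)))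

  edgeSet-delete : ∀ j js → j ∉ js → edgeSet (j ∷ js) Vec.[ j ]≔ false ≡ edgeSet js
  edgeSet-delete j js j∉ = lookup-ext pointwise
    where
    pointwise : ∀ i → lookup (edgeSet (j ∷ js) Vec.[ j ]≔ false) i ≡ lookup (edgeSet js) i
    pointwise i with j Fin.≟ i
    ... | yes ≡.refl = ≡.trans (VecP.lookup∘update j (edgeSet (j ∷ js)) false) (≡.sym (edgeSet-∉ js j∉))
    ... | no j≢i = ≡.trans (VecP.lookup∘update′ (j≢i ∘ ≡.sym) (edgeSet (j ∷ js)) false)
                           (VecP.lookup∘update′ (j≢i ∘ ≡.sym) (edgeSet js) true)

  edgeSet-delete-second : ∀ a b → a ≢ b → edgeSet (a ∷ b ∷ []) Vec.[ b ]≔ false ≡ edgeSet (a ∷ [])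
  edgeSet-delete-second a b a≢b = begin
    edgeSet (a ∷ b ∷ []) Vec.[ b ]≔ false  ≡⟨ ≡.cong (Vec._[ b ]≔ false) (VecP.[]≔-commutes _ b a (a≢b ∘ ≡.sym)) ⟩
    edgeSet (b ∷ a ∷ []) Vec.[ b ]≔ false  ≡⟨ edgeSet-delete b (a ∷ []) (λ { (here b≡a) → a≢b (≡.sym b≡a) }) ⟩
    edgeSet (a ∷ [])                       ∎

  edgeSetExp : EdgeSet → Fin s → ℕ
  edgeSetExp S v = ℕΣ.sum (λ j → if lookup S j then edgeExp j v else 0)

  edgeListExp : List (Fin m) → Fin s → ℕ
  edgeListExp []       v = 0
  edgeListExp (j ∷ js) v = edgeExp j v ℕ.+ edgeListExp js v

  termDeg-lookup : ∀ μ S v → lookup (termDeg μ S) v ≡ lookup μ v ℕ.+ edgeSetExp S v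
  termDeg-lookup μ S v = foldr-lookup (λ i → i)
    where
    step : Fin m → Mon → Mon
    step j ν = if lookup S j then ν · edgeMon j else ν
    foldr-lookup : ∀ {n} (g : Fin n → Fin m) →
      lookup (List.foldr step μ (List.tabulate g)) v
        ≡ lookup μ v ℕ.+ ℕΣ.sum (λ i → if lookup S (g i) then edgeExp (g i) v else 0)
    foldr-lookup {zero} g = ≡.sym (NP.+-identityʳ _)
    foldr-lookup {suc n} g with lookup S (g zero)
    ... | false = foldr-lookup (g ∘ suc)
    ... | true = begin
      lookup (List.foldr step μ (List.tabulate (g ∘ suc)) · edgeMon (g zero)) v
        ≡⟨ lookup-· (List.foldr step μ (List.tabulate (g ∘ suc))) (edgeMon (g zero)) v ⟩
      lookup (List.foldr step μ (List.tabulate (g ∘ suc))) v ℕ.+ edgeExp (g zero) v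
        ≡⟨ ≡.cong (ℕ._+ edgeExp (g zero) v) (foldr-lookup (g ∘ suc)) ⟩
      (lookup μ v ℕ.+ rest) ℕ.+ edgeExp (g zero) v
        ≡⟨ NP.+-assoc (lookup μ v) rest _ ⟩
      lookup μ v ℕ.+ (rest ℕ.+ edgeExp (g zero) v)
        ≡⟨ ≡.cong (lookup μ v ℕ.+_) (NP.+-comm rest _) ⟩
      lookup μ v ℕ.+ (edgeExp (g zero) v ℕ.+ rest)
        ∎
      where rest = ℕΣ.sum (λ i → if lookup S (g (suc i)) then edgeExp (g (suc i)) v else 0)

  edgeSetExp-delete : ∀ S j → lookup S j ≡ true → ∀ v →
                      edgeSetExp S v ≡ edgeSetExp (S Vec.[ j ]≔ false) v ℕ.+ edgeExp j v
  edgeSetExp-delete S j j∈S v = begin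
    edgeSetExp S v                                       ≡⟨ NP.+-identityʳ _ ⟨
    edgeSetExp S v ℕ.+ 0                                 ≡⟨ ≡.cong (edgeSetExp S v ℕ.+_) (≡.sym j∉S′) ⟩
    edgeSetExp S v ℕ.+ term (S Vec.[ j ]≔ false) j       ≡⟨ ℕΣ.sum-swap-at j others ⟩
    edgeSetExp (S Vec.[ j ]≔ false) v ℕ.+ term S j       ≡⟨ ≡.cong (edgeSetExp (S Vec.[ j ]≔ false) v ℕ.+_) j∈S′ ⟩
    edgeSetExp (S Vec.[ j ]≔ false) v ℕ.+ edgeExp j v    ∎
    where
    term : EdgeSet → Fin m → ℕ
    term T i = if lookup T i then edgeExp i v else 0
    j∉S′ : term (S Vec.[ j ]≔ false) j ≡ 0
    j∉S′ rewrite VecP.lookup∘update j S false = ≡.refl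
    j∈S′ : term S j ≡ edgeExp j v
    j∈S′ rewrite j∈S = ≡.refl
    others : ∀ i → i ≢ j → term S i ≡ term (S Vec.[ j ]≔ false) i
    others i i≢j rewrite VecP.lookup∘update′ i≢j S false = ≡.refl

  edgeSetExp-edgeSet : ∀ js → Unique js → ∀ v → edgeSetExp (edgeSet js) v ≡ edgeListExp js v
  edgeSetExp-edgeSet []       _            v =
    ℕΣ.sum-zero (λ i → ≡.cong (λ b → if b then edgeExp i v else 0) (VecP.lookup-replicate i false))
  edgeSetExp-edgeSet (j ∷ js) (j∉ AP.∷ js!) v = begin
    edgeSetExp (edgeSet (j ∷ js)) v                         ≡⟨ edgeSetExp-delete (edgeSet (j ∷ js)) j (edgeSet-∈ (j ∷ js) (here ≡.refl)) v ⟩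
    edgeSetExp (edgeSet (j ∷ js) Vec.[ j ]≔ false) v ℕ.+ edgeExp j v
                                                            ≡⟨ ≡.cong (λ S → edgeSetExp S v ℕ.+ edgeExp j v) (edgeSet-delete j js (All¬⇒¬Any j∉)) ⟩
    edgeSetExp (edgeSet js) v ℕ.+ edgeExp j v               ≡⟨ NP.+-comm _ (edgeExp j v) ⟩
    edgeExp j v ℕ.+ edgeSetExp (edgeSet js) v               ≡⟨ ≡.cong (edgeExp j v ℕ.+_) (edgeSetExp-edgeSet js js! v) ⟩
    edgeListExp (j ∷ js) v                                  ∎

  termDeg-starTerm : ∀ x E j → lookup E j ≡ true → Incident j x → ∀ v →
    lookup (termDeg (cofactor x j) (E Vec.[ j ]≔ false)) v ℕ.+ δ x v ≡ edgeSetExp E v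
  termDeg-starTerm x E j j∈E inc v = begin
    lookup (termDeg (cofactor x j) E′) v ℕ.+ δ x v              ≡⟨ ≡.cong (ℕ._+ δ x v) (termDeg-lookup (cofactor x j) E′ v) ⟩
    (lookup (cofactor x j) v ℕ.+ edgeSetExp E′ v) ℕ.+ δ x v     ≡⟨ ≡.cong (λ μ → (lookup μ v ℕ.+ edgeSetExp E′ v) ℕ.+ δ x v) (cofactor-incident inc) ⟩
    (lookup (varMon y) v ℕ.+ edgeSetExp E′ v) ℕ.+ δ x v        ≡⟨ ≡.cong (λ n → (n ℕ.+ edgeSetExp E′ v) ℕ.+ δ x v) (lookup-varMon y v) ⟩
    (δ y v ℕ.+ edgeSetExp E′ v) ℕ.+ δ x v                      ≡⟨ rearrange (δ y v) (edgeSetExp E′ v) (δ x v) ⟩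
    edgeSetExp E′ v ℕ.+ (δ x v ℕ.+ δ y v)                      ≡⟨ ≡.cong (edgeSetExp E′ v ℕ.+_) (edgeExp-incident inc v) ⟨
    edgeSetExp E′ v ℕ.+ edgeExp j v                            ≡⟨ edgeSetExp-delete E j j∈E v ⟨
    edgeSetExp E v                                             ∎
    where
    E′ = E Vec.[ j ]≔ false
    y = opposite x j
    rearrange : ∀ a b c → (a ℕ.+ b) ℕ.+ c ≡ b ℕ.+ (c ℕ.+ a)
    rearrange = solve-∀

  edgeExp-off-center : ∀ {j x v} → Incident j x → v ≢ x → edgeExp j v ≡ δ (opposite x j) v
  edgeExp-off-center {j} {x} {v} inc v≢x =
    ≡.trans (edgeExp-incident inc v) (≡.cong (ℕ._+ δ (opposite x j) v) (δ-≢ (v≢x ∘ ≡.sym)))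

  edgeListExp-center : ∀ x js → AllIncident x js → edgeListExp js x ≡ List.length js
  edgeListExp-center x []       _ = ≡.refl
  edgeListExp-center x (j ∷ js) (inc All.∷ incs) = ≡.cong₂ ℕ._+_ edgeExp-j-x (edgeListExp-center x js incs)
    where
    edgeExp-j-x : edgeExp j x ≡ 1
    edgeExp-j-x = ≡.trans (edgeExp-incident inc x) (≡.cong₂ ℕ._+_ (δ-refl x) (δ-≢ (opposite≢ inc)))

  edgeListExp-opposite : ∀ x js {j} → AllIncident x js → j ∈ js → 1 ℕ.≤ edgeListExp js (opposite x j)
  edgeListExp-opposite x (h ∷ t) (inc All.∷ _) (here ≡.refl) = NP.≤-trans atHead (NP.m≤m+n _ _)
    where
    atHead : 1 ℕ.≤ edgeExp h (opposite x h)
    atHead rewrite edgeExp-incident inc (opposite x h) | δ-refl (opposite x h) = NP.m≤n+m 1 _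
  edgeListExp-opposite x (h ∷ t) (_ All.∷ incs) (there j∈t) =
    NP.≤-trans (edgeListExp-opposite x t incs j∈t) (NP.m≤n+m _ _)

  edgeListExp-pos⇒joins : ∀ x js v → AllIncident x js → v ≢ x → 1 ℕ.≤ edgeListExp js v →
                          ∃[ j ] j ∈ js × Joins j x v
  edgeListExp-pos⇒joins x (h ∷ t) v (inc All.∷ incs) v≢x pos with opposite x h Fin.≟ v
  ... | yes opp≡v = h , here ≡.refl , ≡.subst (Joins h x) opp≡v (incident⇒joins inc)
  ... | no opp≢v with edgeListExp-pos⇒joins x t v incs v≢x (≡.subst (1 ℕ.≤_) head≡0 pos)
    where
    head≡0 : edgeExp h v ℕ.+ edgeListExp t v ≡ edgeListExp t v
    head≡0 = ≡.cong (ℕ._+ edgeListExp t v) (≡.trans (edgeExp-off-center inc v≢x) (δ-≢ opp≢v))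
  ...   | j , j∈t , J = j , there j∈t , J

  edgeListExp-≤1 : ∀ x js v → Unique js → AllIncident x js → v ≢ x → edgeListExp js v ℕ.≤ 1
  edgeListExp-≤1 x []      v _ _ _ = ℕ.z≤n
  edgeListExp-≤1 x (h ∷ t) v (h∉t AP.∷ t!) (inc All.∷ incs) v≢x =
    ≡.subst (ℕ._≤ 1) (≡.cong (ℕ._+ edgeListExp t v) (≡.sym (edgeExp-off-center inc v≢x))) bound
    where
    tail≡0 : opposite x h ≡ v → edgeListExp t v ≡ 0
    tail≡0 opp≡v with edgeListExp t v in rest
    ... | zero  = ≡.refl
    ... | suc _ with edgeListExp-pos⇒joins x t v incs v≢x (≡.subst (1 ℕ.≤_) (≡.sym rest) (ℕ.s≤s ℕ.z≤n))
    ...   | j , j∈t , J = ⊥-elim (All¬⇒¬Any h∉t (≡.subst (_∈ t) j≡h j∈t))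
      where j≡h = joins-unique J (≡.subst (Joins h x) opp≡v (incident⇒joins inc))
    bound : δ (opposite x h) v ℕ.+ edgeListExp t v ℕ.≤ 1
    bound with opposite x h Fin.≟ v
    ... | no _      = edgeListExp-≤1 x t v t! incs v≢x
    ... | yes opp≡v rewrite tail≡0 opp≡v = NP.≤-refl

  sameExp⇒⊆ : ∀ x js js′ → AllIncident x js → AllIncident x js′ →
              (∀ v → edgeListExp js v ≡ edgeListExp js′ v) → ∀ {j} → j ∈ js → j ∈ js′
  sameExp⇒⊆ x js js′ incs incs′ sameExp {j} j∈ with
    edgeListExp-pos⇒joins x js′ (opposite x j) incs′ (opposite≢ (All.lookup incs j∈))
      (≡.subst (1 ℕ.≤_) (sameExp (opposite x j)) (edgeListExp-opposite x js incs j∈))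
  ... | j′ , j′∈ , J′ = ≡.subst (_∈ js′) (joins-unique J′ (incident⇒joins (All.lookup incs j∈))) j′∈

  sameExp⇒sameEdgeSet : ∀ x js js′ → AllIncident x js → AllIncident x js′ →
                        (∀ v → edgeListExp js v ≡ edgeListExp js′ v) → edgeSet js ≡ edgeSet js′
  sameExp⇒sameEdgeSet x js js′ incs incs′ sameExp = edgeSet-ext js js′
    (sameExp⇒⊆ x js js′ incs incs′ sameExp) (sameExp⇒⊆ x js′ js incs′ incs (≡.sym ∘ sameExp))

  bit : Bool → ℕ
  bit b = if b then 1 else 0

  below-pair : ∀ a b → a ≢ b → ∀ j →
               below (edgeSet (a ∷ b ∷ [])) j ≡ bit (Fin.toℕ a ℕ.<ᵇ Fin.toℕ j) ℕ.+ bit (Fin.toℕ b ℕ.<ᵇ Fin.toℕ j)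
  below-pair a b a≢b j = ≡.trans (length-filter (λ i → i)) (≡.trans (ℕΣ.sum-pair a b a≢b others) (≡.cong₂ ℕ._+_ at-a at-b))
    where
    E = edgeSet (a ∷ b ∷ [])
    p : Fin m → Bool
    p i = lookup E i ∧ (Fin.toℕ i ℕ.<ᵇ Fin.toℕ j)
    length-filter : ∀ {n} (g : Fin n → Fin m) →
                    List.length (List.filterᵇ p (List.tabulate g)) ≡ ℕΣ.sum (λ i → bit (p (g i)))
    length-filter {zero}  g = ≡.refl
    length-filter {suc n} g with p (g zero)
    ... | true  = ≡.cong suc (length-filter (g ∘ suc))
    ... | false = length-filter (g ∘ suc)
    others : ∀ i → i ≢ a → i ≢ b → bit (p i) ≡ 0
    others i i≢a i≢b rewrite edgeSet-∉ (a ∷ b ∷ []) (λ { (here i≡a) → i≢a i≡a ; (there (here i≡b)) → i≢b i≡b }) = ≡.refl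
    at-a : bit (p a) ≡ bit (Fin.toℕ a ℕ.<ᵇ Fin.toℕ j)
    at-a rewrite edgeSet-∈ (a ∷ b ∷ []) (here ≡.refl) = ≡.refl
    at-b : bit (p b) ≡ bit (Fin.toℕ b ℕ.<ᵇ Fin.toℕ j)
    at-b rewrite edgeSet-∈ {b} (a ∷ b ∷ []) (there (here ≡.refl)) = ≡.refl

  <ᵇ-irrefl : ∀ n → (n ℕ.<ᵇ n) ≡ false
  <ᵇ-irrefl zero    = ≡.refl
  <ᵇ-irrefl (suc n) = <ᵇ-irrefl n

  bit-<ᵇ-exclusive : ∀ p q → p ≢ q → bit (q ℕ.<ᵇ p) ℕ.+ bit (p ℕ.<ᵇ q) ≡ 1
  bit-<ᵇ-exclusive zero    zero    p≢q = ⊥-elim (p≢q ≡.refl)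
  bit-<ᵇ-exclusive zero    (suc q) _   = ≡.refl
  bit-<ᵇ-exclusive (suc p) zero    _   = ≡.refl
  bit-<ᵇ-exclusive (suc p) (suc q) p≢q = bit-<ᵇ-exclusive p q (p≢q ∘ ≡.cong suc)

  below-pair-sum : ∀ a b → a ≢ b → below (edgeSet (a ∷ b ∷ [])) a ℕ.+ below (edgeSet (a ∷ b ∷ [])) b ≡ 1
  below-pair-sum a b a≢b
    rewrite below-pair a b a≢b a | below-pair a b a≢b b | <ᵇ-irrefl (Fin.toℕ a) | <ᵇ-irrefl (Fin.toℕ b)
          | NP.+-identityʳ (bit (Fin.toℕ a ℕ.<ᵇ Fin.toℕ b))
    = bit-<ᵇ-exclusive (Fin.toℕ a) (Fin.toℕ b) (a≢b ∘ toℕ-injective)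

module StarRelations {c ℓ} (F : Field c ℓ) (Γ : Graph) where
  open Field F hiding (zero)
  open Graph Γ
  open Koszul F Γ
  open Combinatorics F Γ
  open FiniteSums +-commutativeMonoid
  open Signs commutativeRing
  open import Algebra.Properties.Ring ring using (-1*x≈-x; -0#≈0#; -‿injective; -‿distribˡ-*; x∙y⁻¹≈ε⇒x≈y)
  open import Algebra.Properties.Semiring.Sum semiring using (*-distribˡ-sum; *-distribʳ-sum)
  open import Relation.Binary.Reasoning.Setoid setoid

  termCoeff : Term → Mon → EdgeSet → Carrier
  termCoeff (a , μ , S) ν T =
    if does (VecP.≡-dec ℕ._≟_ μ ν) ∧ does (VecP.≡-dec Bool._≟_ S T) then a else 0#

  coeff-∷ : ∀ t xs ν T → coeff (t ∷ xs) ν T ≈ termCoeff t ν T + coeff xs ν T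
  coeff-∷ (a , μ , S) xs ν T with does (VecP.≡-dec ℕ._≟_ μ ν) ∧ does (VecP.≡-dec Bool._≟_ S T)
  ... | true  = refl
  ... | false = sym (+-identityˡ _)

  coeff-[_] : ∀ t ν T → coeff (t ∷ []) ν T ≈ termCoeff t ν T
  coeff-[ t ] ν T = trans (coeff-∷ t [] ν T) (+-identityʳ _)

  termCoeff-self : ∀ a μ S → termCoeff (a , μ , S) μ S ≈ a
  termCoeff-self a μ S with VecP.≡-dec ℕ._≟_ μ μ | VecP.≡-dec Bool._≟_ S S
  ... | yes _ | yes _   = refl
  ... | yes _ | no S≢S  = ⊥-elim (S≢S ≡.refl)
  ... | no μ≢μ | _      = ⊥-elim (μ≢μ ≡.refl)

  termCoeff-miss : ∀ a μ S ν T → ¬ (μ ≡ ν × S ≡ T) → termCoeff (a , μ , S) ν T ≈ 0#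
  termCoeff-miss a μ S ν T miss with VecP.≡-dec ℕ._≟_ μ ν | VecP.≡-dec Bool._≟_ S T
  ... | yes μ≡ν | yes S≡T = ⊥-elim (miss (μ≡ν , S≡T))
  ... | yes _   | no _    = refl
  ... | no _    | _       = refl

  termCoeff-* : ∀ a b μ S ν T → termCoeff (a * b , μ , S) ν T ≈ a * termCoeff (b , μ , S) ν T
  termCoeff-* a b μ S ν T with does (VecP.≡-dec ℕ._≟_ μ ν) ∧ does (VecP.≡-dec Bool._≟_ S T)
  ... | true  = refl
  ... | false = sym (zeroʳ a)

  termCoeff-cong : ∀ {a b} μ S ν T → a ≈ b → termCoeff (a , μ , S) ν T ≈ termCoeff (b , μ , S) ν T
  termCoeff-cong μ S ν T a≈b with does (VecP.≡-dec ℕ._≟_ μ ν) ∧ does (VecP.≡-dec Bool._≟_ S T)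
  ... | true  = a≈b
  ... | false = refl

  termCoeff-unit : ∀ a μ S ν T → termCoeff (a , μ , S) ν T ≈ a * termCoeff (1# , μ , S) ν T
  termCoeff-unit a μ S ν T with does (VecP.≡-dec ℕ._≟_ μ ν) ∧ does (VecP.≡-dec Bool._≟_ S T)
  ... | true  = sym (*-identityʳ a)
  ... | false = sym (zeroʳ a)

  coeff-++ : ∀ xs ys ν T → coeff (xs ++ ys) ν T ≈ coeff xs ν T + coeff ys ν T
  coeff-++ []       ys ν T = sym (+-identityˡ _)
  coeff-++ (t ∷ xs) ys ν T = begin
    coeff (t ∷ (xs ++ ys)) ν T                        ≈⟨ coeff-∷ t (xs ++ ys) ν T ⟩
    termCoeff t ν T + coeff (xs ++ ys) ν T            ≈⟨ +-congˡ (coeff-++ xs ys ν T) ⟩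
    termCoeff t ν T + (coeff xs ν T + coeff ys ν T)   ≈⟨ +-assoc _ _ _ ⟨
    (termCoeff t ν T + coeff xs ν T) + coeff ys ν T   ≈⟨ +-congʳ (coeff-∷ t xs ν T) ⟨
    coeff (t ∷ xs) ν T + coeff ys ν T                 ∎

  coeff-scale : ∀ a xs ν T → coeff (scale a xs) ν T ≈ a * coeff xs ν T
  coeff-scale a []                 ν T = sym (zeroʳ a)
  coeff-scale a ((b , μ , S) ∷ xs) ν T = begin
    coeff ((a * b , μ , S) ∷ scale a xs) ν T                          ≈⟨ coeff-∷ (a * b , μ , S) (scale a xs) ν T ⟩
    termCoeff (a * b , μ , S) ν T + coeff (scale a xs) ν T            ≈⟨ +-cong (termCoeff-* a b μ S ν T) (coeff-scale a xs ν T) ⟩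
    a * termCoeff (b , μ , S) ν T + a * coeff xs ν T                  ≈⟨ distribˡ a _ _ ⟨
    a * (termCoeff (b , μ , S) ν T + coeff xs ν T)                    ≈⟨ *-congˡ (coeff-∷ (b , μ , S) xs ν T) ⟨
    a * coeff ((b , μ , S) ∷ xs) ν T                                  ∎

  coeff-neg : ∀ xs ν T → coeff (neg xs) ν T ≈ - coeff xs ν T
  coeff-neg xs ν T = trans (coeff-scale (- 1#) xs ν T) (-1*x≈-x _)

  coeff-difference : ∀ z z′ ν T → coeff (z ++ neg z′) ν T ≈ coeff z ν T - coeff z′ ν T
  coeff-difference z z′ ν T = trans (coeff-++ z (neg z′) ν T) (+-congˡ (coeff-neg z′ ν T))

  ≋⇒HEq : ∀ z z′ → z ≋ z′ → HEq z z′
  ≋⇒HEq z z′ z≋z′ = [] , λ ν T →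
    trans (coeff-difference z z′ ν T) (trans (+-congʳ (z≋z′ ν T)) (-‿inverseʳ _))

  HEq-respʳ-≋ : ∀ z y y′ → y ≋ y′ → HEq z y → HEq z y′
  HEq-respʳ-≋ z y y′ y≋y′ (w , z-y≋dw) = w , λ ν T → begin
    coeff (z ++ neg y′) ν T        ≈⟨ coeff-difference z y′ ν T ⟩
    coeff z ν T - coeff y′ ν T     ≈⟨ +-congˡ (-‿cong (y≋y′ ν T)) ⟨
    coeff z ν T - coeff y ν T      ≈⟨ coeff-difference z y ν T ⟨
    coeff (z ++ neg y) ν T         ≈⟨ z-y≋dw ν T ⟩
    coeff (d w) ν T                ∎

  coeff-d-varMon : ∀ w y T → coeff (d w) (varMon y) T ≈ 0#
  coeff-d-varMon []                  y T = refl
  coeff-d-varMon (t@(a , μ , S) ∷ w) y T = begin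
    coeff (dTerm t ++ d w) (varMon y) T                        ≈⟨ coeff-++ (dTerm t) (d w) (varMon y) T ⟩
    coeff (dTerm t) (varMon y) T + coeff (d w) (varMon y) T    ≈⟨ +-cong (terms≈0 (List.filterᵇ (lookup S) (List.allFin m))) (coeff-d-varMon w y T) ⟩
    0# + 0#                                                    ≈⟨ +-identityˡ 0# ⟩
    0#                                                         ∎
    where
    term : Fin m → Term
    term j = (sgn (below S j) * a , μ · edgeMon j , S Vec.[ j ]≔ false)
    terms≈0 : ∀ js → coeff (List.map term js) (varMon y) T ≈ 0#
    terms≈0 []       = refl
    terms≈0 (j ∷ js) = trans (coeff-∷ (term j) (List.map term js) (varMon y) T)
      (trans (+-cong (termCoeff-miss (sgn (below S j) * a) (μ · edgeMon j) (S Vec.[ j ]≔ false) (varMon y) T (·edgeMon≢varMon μ j y ∘ proj₁)) (terms≈0 js)) (+-identityˡ 0#))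

  HEq⇒coeff-varMon : ∀ z z′ → HEq z z′ → ∀ y T → coeff z (varMon y) T ≈ coeff z′ (varMon y) T
  HEq⇒coeff-varMon z z′ (w , z-z′≋dw) y T = x∙y⁻¹≈ε⇒x≈y _ _ (begin
    coeff z (varMon y) T - coeff z′ (varMon y) T   ≈⟨ coeff-difference z z′ (varMon y) T ⟨
    coeff (z ++ neg z′) (varMon y) T               ≈⟨ z-z′≋dw (varMon y) T ⟩
    coeff (d w) (varMon y) T                       ≈⟨ coeff-d-varMon w y T ⟩
    0#                                             ∎)

  coeff-lincomb : ∀ k b σ ν T → coeff (lincomb k b σ) ν T ≈ sum (λ i → b i * coeff (rep (σ i)) ν T)
  coeff-lincomb k b σ ν T = trans (coeff-concat (λ i → i)) (sum-cong-≋ (λ i → coeff-scale (b i) (rep (σ i)) ν T))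
    where
    coeff-concat : ∀ {n} (g : Fin n → Fin k) →
      coeff (List.concatMap (λ i → scale (b i) (rep (σ i))) (List.tabulate g)) ν T
        ≈ sum (λ i → coeff (scale (b (g i)) (rep (σ (g i)))) ν T)
    coeff-concat {zero}  g = refl
    coeff-concat {suc n} g = trans (coeff-++ (scale (b (g zero)) (rep (σ (g zero)))) _ ν T) (+-congˡ (coeff-concat (g ∘ suc)))

  wedgeSign : List (Fin m) → Carrier
  wedgeSign []       = 1#
  wedgeSign (j ∷ js) = sgn (below (edgeSet js) j) * wedgeSign js

  sgn-isSign : ∀ n → IsSign (sgn n)
  sgn-isSign zero    = inj₁ refl
  sgn-isSign (suc n) = isSign-neg (sgn-isSign n)

  wedgeSign-isSign : ∀ js → IsSign (wedgeSign js)
  wedgeSign-isSign []       = inj₁ refl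
  wedgeSign-isSign (j ∷ js) = isSign-* (sgn-isSign (below (edgeSet js) j)) (wedgeSign-isSign js)

  wedgeList-unique : ∀ js → Unique js → wedgeList js ≡ (wedgeSign js , oneMon , edgeSet js) ∷ []
  wedgeList-unique []       _            = ≡.refl
  wedgeList-unique (j ∷ js) (j∉ AP.∷ js!)
    rewrite wedgeList-unique js js! | edgeSet-∉ js (All¬⇒¬Any j∉) = ≡.refl

  -- starCoeff x E: the coefficients of (1/x) d e_E, e_E the wedge of E in increasing edge order
  starSummand : Fin s → EdgeSet → Fin m → Mon → EdgeSet → Carrier
  starSummand x E j ν T =
    if lookup E j then termCoeff (sgn (below E j) , cofactor x j , E Vec.[ j ]≔ false) ν T else 0#

  starCoeff : Fin s → EdgeSet → Mon → EdgeSet → Carrier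
  starCoeff x E ν T = sum (λ j → starSummand x E j ν T)

  starRep-coeff : ∀ x js → Unique js → ∀ ν T → coeff (starRep x js) ν T ≈ wedgeSign js * starCoeff x (edgeSet js) ν T
  starRep-coeff x js js! ν T
    rewrite wedgeList-unique js js! | ListP.++-identityʳ (dTerm (wedgeSign js , oneMon , edgeSet js)) =
    trans (coeff-terms (λ i → i)) (trans (sum-cong-≋ summand) (sym (*-distribˡ-sum (wedgeSign js) (λ j → starSummand x E j ν T))))
    where
    E = edgeSet js
    term : Fin m → Term
    term j = (sgn (below E j) * wedgeSign js , oneMon · edgeMon j , E Vec.[ j ]≔ false)
    coeff-terms : ∀ {n} (g : Fin n → Fin m) →
      coeff (divVar x (List.map term (List.filterᵇ (lookup E) (List.tabulate g)))) ν T
        ≈ sum (λ i → if lookup E (g i) then coeff (divVar x (term (g i) ∷ [])) ν T else 0#)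
    coeff-terms {zero}  g = refl
    coeff-terms {suc n} g with lookup E (g zero)
    ... | true  = trans (coeff-++ (divVar x (term (g zero) ∷ [])) (divVar x (List.map term (List.filterᵇ (lookup E) (List.tabulate (g ∘ suc))))) ν T) (+-congˡ (coeff-terms (g ∘ suc)))
    ... | false = trans (coeff-terms (g ∘ suc)) (sym (+-identityˡ _))
    summand : ∀ j → (if lookup E j then coeff (divVar x (term j ∷ [])) ν T else 0#) ≈ wedgeSign js * starSummand x E j ν T
    summand j with lookup E j
    ... | true  = trans (coeff-[ (sgn (below E j) * wedgeSign js , cofactor x j , E Vec.[ j ]≔ false) ] ν T)
                    (trans (termCoeff-cong (cofactor x j) (E Vec.[ j ]≔ false) ν T (*-comm _ _))
                           (termCoeff-* (wedgeSign js) _ (cofactor x j) (E Vec.[ j ]≔ false) ν T))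
    ... | false = sym (zeroʳ _)

  edgeSet-incident : ∀ x js → AllIncident x js → ∀ j → lookup (edgeSet js) j ≡ true → Incident j x
  edgeSet-incident x js incs j j∈ = All.lookup incs (edgeSet-true⇒∈ js j∈)

  starSummand-∈ : ∀ x E j → lookup E j ≡ true → ∀ ν T →
    starSummand x E j ν T ≈ sgn (below E j) * termCoeff (1# , cofactor x j , E Vec.[ j ]≔ false) ν T
  starSummand-∈ x E j j∈E ν T rewrite j∈E = termCoeff-unit _ (cofactor x j) (E Vec.[ j ]≔ false) ν T

  starCoeff-miss : ∀ x E ν T → (∀ j → lookup E j ≡ true → ¬ (cofactor x j ≡ ν × E Vec.[ j ]≔ false ≡ T)) →
                   starCoeff x E ν T ≈ 0#
  starCoeff-miss x E ν T miss = sum-zero summand≈0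
    where
    summand≈0 : ∀ j → starSummand x E j ν T ≈ 0#
    summand≈0 j with lookup E j in j∈E
    ... | false = refl
    ... | true  = termCoeff-miss _ (cofactor x j) (E Vec.[ j ]≔ false) ν T (miss j j∈E)

  starCoeff-center : ∀ x E → (∀ j → lookup E j ≡ true → Incident j x) → ∀ T → starCoeff x E (varMon x) T ≈ 0#
  starCoeff-center x E incs T = starCoeff-miss x E (varMon x) T λ j j∈E (cofactor≡x , _) →
    opposite≢ (incs j j∈E) (varMon-injective (≡.trans (≡.sym (cofactor-incident (incs j j∈E))) cofactor≡x))

  starCoeff-offVariables : ∀ x E → (∀ j → lookup E j ≡ true → Incident j x) →
                           ∀ ν T → (∀ y → ν ≢ varMon y) → starCoeff x E ν T ≈ 0#
  starCoeff-offVariables x E incs ν T ν≢var = starCoeff-miss x E ν T λ j j∈E (cofactor≡ν , _) →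
    ν≢var (opposite x j) (≡.trans (≡.sym cofactor≡ν) (cofactor-incident (incs j j∈E)))

  starCoeff-at : ∀ x E h → lookup E h ≡ true → starCoeff x E (cofactor x h) (E Vec.[ h ]≔ false) ≈ sgn (below E h)
  starCoeff-at x E h h∈E = trans (sum-single h others≈0) at-h
    where
    at-h : starSummand x E h (cofactor x h) (E Vec.[ h ]≔ false) ≈ sgn (below E h)
    at-h rewrite h∈E = termCoeff-self _ (cofactor x h) (E Vec.[ h ]≔ false)
    others≈0 : ∀ j → j ≢ h → starSummand x E j (cofactor x h) (E Vec.[ h ]≔ false) ≈ 0#
    others≈0 j j≢h with lookup E j
    ... | false = refl
    ... | true  = termCoeff-miss _ (cofactor x j) (E Vec.[ j ]≔ false) _ _ λ (_ , same) →
      differ-at-h (≡.cong (λ S → lookup S h) same)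
      where
      differ-at-h : lookup (E Vec.[ j ]≔ false) h ≢ lookup (E Vec.[ h ]≔ false) h
      differ-at-h eq with ≡.trans (≡.sym (≡.trans (VecP.lookup∘update′ (j≢h ∘ ≡.sym) E false) h∈E))
                                  (≡.trans eq (VecP.lookup∘update h E false))
      ... | ()

  Coeffs : Set c
  Coeffs = Mon → EdgeSet → Carrier

  _∝⟨_⟩_ : Coeffs → Carrier → Coeffs → Set ℓ
  f ∝⟨ u ⟩ g = ∀ ν T → f ν T ≈ u * g ν T

  ∝-trans : ∀ {f g h u v} → f ∝⟨ u ⟩ g → g ∝⟨ v ⟩ h → f ∝⟨ u * v ⟩ h
  ∝-trans {u = u} {v} f∝g g∝h ν T = trans (f∝g ν T) (trans (*-congˡ (g∝h ν T)) (sym (*-assoc u v _)))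

  ∝-sym : ∀ {f g u} → IsSign u → f ∝⟨ u ⟩ g → g ∝⟨ u ⟩ f
  ∝-sym {f} {g} {u} ±u f∝g ν T = trans (sym (sign-cancelˡ (g ν T) ±u)) (*-congˡ (sym (f∝g ν T)))

  OnVariables : Elem → Set ℓ
  OnVariables z = ∀ μ S → (∀ y → μ ≢ varMon y) → coeff z μ S ≈ 0#

  onVariables-neg : ∀ z → OnVariables z → OnVariables (neg z)
  onVariables-neg z z-on μ S μ≢var =
    trans (coeff-neg z μ S) (trans (-‿cong (z-on μ S μ≢var)) -0#≈0#)

  HEq⇒≋ : ∀ z z′ → OnVariables z → OnVariables z′ → HEq z z′ → z ≋ z′
  HEq⇒≋ z z′ z-on z′-on z~z′ μ S with FinP.any? (λ y → VecP.≡-dec ℕ._≟_ μ (varMon y))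
  ... | yes (y , ≡.refl) = HEq⇒coeff-varMon z z′ z~z′ y S
  ... | no μ≢var = trans (z-on μ S μ≢var′) (sym (z′-on μ S μ≢var′))
    where
    μ≢var′ : ∀ y → μ ≢ varMon y
    μ≢var′ y μ≡y = μ≢var (y , μ≡y)

  HEq±⇒∝ : ∀ z z′ → OnVariables z → OnVariables z′ → HEq± z z′ → ∃[ u ] IsSign u × coeff z ∝⟨ u ⟩ coeff z′
  HEq±⇒∝ z z′ z-on z′-on (inj₁ z~z′) =
    1# , inj₁ refl , λ ν T → trans (HEq⇒≋ z z′ z-on z′-on z~z′ ν T) (sym (*-identityˡ _))
  HEq±⇒∝ z z′ z-on z′-on (inj₂ z~-z′) =
    - 1# , inj₂ refl , λ ν T → trans (HEq⇒≋ z (neg z′) z-on (onVariables-neg z′ z′-on) z~-z′ ν T) (coeff-scale (- 1#) z′ ν T)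

  ∝⇒HEq± : ∀ z z′ {u} → IsSign u → coeff z ∝⟨ u ⟩ coeff z′ → HEq± z z′
  ∝⇒HEq± z z′ (inj₁ u≈1) z∝z′ =
    inj₁ (≋⇒HEq z z′ λ ν T → trans (z∝z′ ν T) (trans (*-congʳ u≈1) (*-identityˡ _)))
  ∝⇒HEq± z z′ (inj₂ u≈-1) z∝z′ =
    inj₂ (≋⇒HEq z (neg z′) λ ν T → trans (z∝z′ ν T) (trans (*-congʳ u≈-1) (sym (coeff-scale (- 1#) z′ ν T))))

  HasDeg-∝ : ∀ z z′ {u D} → coeff z ∝⟨ u ⟩ coeff z′ → HasDeg z′ D → HasDeg z D
  HasDeg-∝ z z′ {u} z∝z′ z′-deg μ S z≉0 = z′-deg μ S (λ z′≈0 → z≉0 (trans (z∝z′ μ S) (trans (*-congˡ z′≈0) (zeroʳ u))))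

  ¬HEq-lincomb-varMon : ∀ z k b σ y T → ¬ (coeff z (varMon y) T ≈ 0#) →
    (∀ i → b i * coeff (rep (σ i)) (varMon y) T ≈ 0#) → ¬ HEq z (lincomb k b σ)
  ¬HEq-lincomb-varMon z k b σ y T z≉0 terms≈0 z~comb =
    z≉0 (trans (HEq⇒coeff-varMon z (lincomb k b σ) z~comb y T) (trans (coeff-lincomb k b σ (varMon y) T) (sum-zero terms≈0)))

  ¬HEq±-varMon : ∀ z z′ y T → coeff z (varMon y) T ≈ 0# → ¬ (coeff z′ (varMon y) T ≈ 0#) →
                 ¬ HEq z z′ × ¬ HEq z (neg z′)
  ¬HEq±-varMon z z′ y T z≈0 z′≉0 =
    (λ z~z′ → z′≉0 (trans (sym (HEq⇒coeff-varMon z z′ z~z′ y T)) z≈0)) ,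
    (λ z~-z′ → z′≉0 (-‿injective (trans (sym (coeff-neg z′ (varMon y) T))
                                  (trans (sym (HEq⇒coeff-varMon z (neg z′) z~-z′ y T)) (trans z≈0 (sym -0#≈0#))))))

  starRep-coeff≉0 : ∀ x js → Unique js → ∀ {h} → h ∈ js →
                    ¬ (coeff (starRep x js) (cofactor x h) (edgeSet js Vec.[ h ]≔ false) ≈ 0#)
  starRep-coeff≉0 x js js! {h} h∈ coeff≈0 =
    isSign⇒≉0 0≉1 (isSign-* (wedgeSign-isSign js) (sgn-isSign (below (edgeSet js) h)))
      (trans (sym (trans (starRep-coeff x js js! _ _) (*-congˡ (starCoeff-at x (edgeSet js) h (edgeSet-∈ js h∈))))) coeff≈0)

  starDegree : ∀ x js → Unique js → AllIncident x js → js ≢ [] → ∀ D → HasDeg (starRep x js) D →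
               ∀ v → lookup D v ℕ.+ δ x v ≡ edgeListExp js v
  starDegree x []      _   _    []≢[] _ _   _ = ⊥-elim ([]≢[] ≡.refl)
  starDegree x (h ∷ t) js! incs _     D deg v = ≡.trans (≡.cong (λ μ → lookup μ v ℕ.+ δ x v) (≡.sym D≡))
    (≡.trans (termDeg-starTerm x (edgeSet (h ∷ t)) h (edgeSet-∈ (h ∷ t) (here ≡.refl)) (All.lookup incs (here ≡.refl)) v)
             (edgeSetExp-edgeSet (h ∷ t) js! v))
    where
    D≡ = deg (cofactor x h) (edgeSet (h ∷ t) Vec.[ h ]≔ false) (starRep-coeff≉0 x (h ∷ t) js! (here ≡.refl))

  starRep-hasDeg : ∀ x js → Unique js → AllIncident x js → ∀ D → (∀ v → lookup D v ℕ.+ δ x v ≡ edgeListExp js v) →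
                   HasDeg (starRep x js) D
  starRep-hasDeg x js js! incs D D-exp μ S coeff≉0
    with FinP.any? (λ j → (lookup E j Bool.≟ true) ×-dec VecP.≡-dec ℕ._≟_ (cofactor x j) μ ×-dec VecP.≡-dec Bool._≟_ (E Vec.[ j ]≔ false) S)
    where E = edgeSet js
  ... | yes (j , j∈E , ≡.refl , ≡.refl) = lookup-ext λ v → NP.+-cancelʳ-≡ _ _ _
          (≡.trans (termDeg-starTerm x (edgeSet js) j j∈E (edgeSet-incident x js incs j j∈E) v)
                   (≡.trans (edgeSetExp-edgeSet js js! v) (≡.sym (D-exp v))))
  ... | no no-term = ⊥-elim (coeff≉0 (trans (starRep-coeff x js js! μ S)
          (trans (*-congˡ (starCoeff-miss x (edgeSet js) μ S λ j j∈E (cofactor≡ , S≡) → no-term (j , j∈E , cofactor≡ , S≡)))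
                 (zeroʳ _))))

  rep-degree : ∀ (τ : Star) D → HasDeg (rep τ) D →
                ∀ v → lookup D v ℕ.+ δ (Star.center τ) v ≡ edgeListExp (Star.edges τ) v
  rep-degree τ = starDegree (Star.center τ) (Star.edges τ) (Star.distinct τ) (Star.incident τ) (Star.nonempty τ)

  starRep-onVariables : ∀ x js → Unique js → AllIncident x js → OnVariables (starRep x js)
  starRep-onVariables x js js! incs μ S μ≢var = trans (starRep-coeff x js js! μ S)
    (trans (*-congˡ (starCoeff-offVariables x (edgeSet js) (edgeSet-incident x js incs) μ S μ≢var)) (zeroʳ _))

  rep-onVariables : ∀ (τ : Star) → OnVariables (rep τ)
  rep-onVariables τ = starRep-onVariables (Star.center τ) (Star.edges τ) (Star.distinct τ) (Star.incident τ)

  starRep-center : ∀ x js → Unique js → AllIncident x js → ∀ T → coeff (starRep x js) (varMon x) T ≈ 0#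
  starRep-center x js js! incs T = trans (starRep-coeff x js js! (varMon x) T)
    (trans (*-congˡ (starCoeff-center x (edgeSet js) (edgeSet-incident x js incs) T)) (zeroʳ _))

  rep-center : ∀ (τ : Star) T → coeff (rep τ) (varMon (Star.center τ)) T ≈ 0#
  rep-center τ = starRep-center (Star.center τ) (Star.edges τ) (Star.distinct τ) (Star.incident τ)

  sameEdgeSet⇒∝ : ∀ x js js′ → Unique js → Unique js′ → edgeSet js ≡ edgeSet js′ →
                  coeff (starRep x js) ∝⟨ wedgeSign js * wedgeSign js′ ⟩ coeff (starRep x js′)
  sameEdgeSet⇒∝ x js js′ js! js′! same = ∝-trans {g = starCoeff x (edgeSet js)} (starRep-coeff x js js!)
    (∝-sym (wedgeSign-isSign js′) λ ν T →
      ≡.subst (λ E → coeff (starRep x js′) ν T ≈ wedgeSign js′ * starCoeff x E ν T) (≡.sym same) (starRep-coeff x js′ js′! ν T))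

  sameDegree⇒∝ : ∀ (τ : Star) {x} js → Unique js → AllIncident x js → ∀ D → HasDeg (rep τ) D →
    (∀ v → lookup D v ℕ.+ δ x v ≡ edgeListExp js v) → Star.center τ ≡ x →
    coeff (rep τ) ∝⟨ wedgeSign (Star.edges τ) * wedgeSign js ⟩ coeff (starRep x js)
  sameDegree⇒∝ τ js js! incs D deg D-exp ≡.refl =
    sameEdgeSet⇒∝ (Star.center τ) (Star.edges τ) js (Star.distinct τ) js!
      (sameExp⇒sameEdgeSet (Star.center τ) (Star.edges τ) js (Star.incident τ) incs
        (λ v → ≡.trans (≡.sym (rep-degree τ D deg v)) (D-exp v)))

  sameDegree⇒HEq± : ∀ (τ : Star) {x} js → Unique js → AllIncident x js → ∀ D → HasDeg (rep τ) D →
    (∀ v → lookup D v ℕ.+ δ x v ≡ edgeListExp js v) → Star.center τ ≡ x → HEq± (rep τ) (starRep x js)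
  sameDegree⇒HEq± τ {x} js js! incs D deg D-exp center≡x =
    ∝⇒HEq± (rep τ) (starRep x js) (isSign-* (wedgeSign-isSign (Star.edges τ)) (wedgeSign-isSign js))
      (sameDegree⇒∝ τ js js! incs D deg D-exp center≡x)

  length≡centerExp+1 : ∀ (τ : Star) D → HasDeg (rep τ) D →
                       List.length (Star.edges τ) ≡ lookup D (Star.center τ) ℕ.+ 1
  length≡centerExp+1 τ D deg = ≡.trans (≡.sym (edgeListExp-center x (Star.edges τ) (Star.incident τ)))
    (≡.trans (≡.sym (rep-degree τ D deg x)) (≡.cong (lookup D x ℕ.+_) (δ-refl x)))
    where x = Star.center τ

  sgn-+ : ∀ p q → sgn (p ℕ.+ q) ≈ sgn p * sgn q
  sgn-+ zero    q = sym (*-identityˡ _)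
  sgn-+ (suc p) q = trans (-‿cong (sgn-+ p q)) (-‿distribˡ-* (sgn p) (sgn q))

  sgn-pair : ∀ a b → a ≢ b → sgn (below (edgeSet (a ∷ b ∷ [])) a) * sgn (below (edgeSet (a ∷ b ∷ [])) b) ≈ - 1#
  sgn-pair a b a≢b = trans (sym (sgn-+ (below E a) (below E b))) (reflexive (≡.cong sgn (below-pair-sum a b a≢b)))
    where E = edgeSet (a ∷ b ∷ [])

  starCoeff-pair : ∀ x {a b ya yb} → Joins a x ya → Joins b x yb → a ≢ b → ∀ ν T →
    starCoeff x (edgeSet (a ∷ b ∷ [])) ν T
      ≈ sgn (below (edgeSet (a ∷ b ∷ [])) a) * termCoeff (1# , varMon ya , edgeSet (b ∷ [])) ν T
      + sgn (below (edgeSet (a ∷ b ∷ [])) b) * termCoeff (1# , varMon yb , edgeSet (a ∷ [])) ν T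
  starCoeff-pair x {a} {b} {ya} {yb} Ja Jb a≢b ν T = begin
    starCoeff x E ν T                                       ≈⟨ sum-pair a b a≢b others≈0 ⟩
    starSummand x E a ν T + starSummand x E b ν T           ≈⟨ +-cong (starSummand-∈ x E a (edgeSet-∈ (a ∷ b ∷ []) (here ≡.refl)) ν T)
                                                                      (starSummand-∈ x E b (edgeSet-∈ {b} (a ∷ b ∷ []) (there (here ≡.refl))) ν T) ⟩
    sgn (below E a) * termCoeff (1# , cofactor x a , E Vec.[ a ]≔ false) ν T
      + sgn (below E b) * termCoeff (1# , cofactor x b , E Vec.[ b ]≔ false) ν T
      ≡⟨ ≡.cong₂ _+_ (≡.cong₂ (λ μ S → sgn (below E a) * termCoeff (1# , μ , S) ν T) (cofactor-joins Ja) (edgeSet-delete a (b ∷ []) a∉))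
                     (≡.cong₂ (λ μ S → sgn (below E b) * termCoeff (1# , μ , S) ν T) (cofactor-joins Jb) (edgeSet-delete-second a b a≢b)) ⟩
    sgn (below E a) * termCoeff (1# , varMon ya , edgeSet (b ∷ [])) ν T
      + sgn (below E b) * termCoeff (1# , varMon yb , edgeSet (a ∷ [])) ν T ∎
    where
    E = edgeSet (a ∷ b ∷ [])
    a∉ : a ∉ b ∷ []
    a∉ (here a≡b) = a≢b a≡b
    cofactor-joins : ∀ {j y} → Joins j x y → cofactor x j ≡ varMon y
    cofactor-joins J = ≡.trans (cofactor-incident (joins⇒incident J)) (≡.cong varMon (opposite-joins J))
    others≈0 : ∀ i → i ≢ a → i ≢ b → starSummand x E i ν T ≈ 0#
    others≈0 i i≢a i≢b rewrite edgeSet-∉ (a ∷ b ∷ []) (λ { (here i≡a) → i≢a i≡a ; (there (here i≡b)) → i≢b i≡b }) = refl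

  sameDegree⇒HEq±-manyEdges : ∀ x₀ js₀ → Unique js₀ → AllIncident x₀ js₀ → 3 ℕ.≤ List.length js₀ →
    ∀ D → (∀ v → lookup D v ℕ.+ δ x₀ v ≡ edgeListExp js₀ v) →
    ∀ (τ : Star) → HasDeg (rep τ) D → HEq± (rep τ) (starRep x₀ js₀)
  sameDegree⇒HEq±-manyEdges x₀ js₀ js₀! incs₀ 3≤len D D-exp τ deg with Star.center τ Fin.≟ x₀
  ... | yes x≡x₀ = sameDegree⇒HEq± τ js₀ js₀! incs₀ D deg D-exp x≡x₀
  -- a star has exponent ≤ 1 off its centre, while D has exponent ≥ 2 at x₀
  ... | no x≢x₀ = ⊥-elim (3≰2 (NP.≤-trans 3≤D+1 (NP.+-monoˡ-≤ 1 D≤1)))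
    where
    3≰2 : ¬ (3 ℕ.≤ 2)
    3≰2 (ℕ.s≤s (ℕ.s≤s ()))
    3≤D+1 : 3 ℕ.≤ lookup D x₀ ℕ.+ 1
    3≤D+1 = ≡.subst (3 ℕ.≤_) (≡.sym (≡.trans (≡.cong (lookup D x₀ ℕ.+_) (≡.sym (δ-refl x₀)))
                                          (≡.trans (D-exp x₀) (edgeListExp-center x₀ js₀ incs₀)))) 3≤len
    D≤1 : lookup D x₀ ℕ.≤ 1
    D≤1 = NP.≤-trans (NP.m≤m+n _ _) (NP.≤-trans (NP.≤-reflexive (rep-degree τ D deg x₀))
            (edgeListExp-≤1 (Star.center τ) (Star.edges τ) x₀ (Star.distinct τ) (Star.incident τ) (x≢x₀ ∘ ≡.sym)))

  oneEdgeStar-∝ : ∀ x a → Incident a x →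
    coeff (starRep x (a ∷ [])) ∝⟨ wedgeSign (a ∷ []) * sgn (below (edgeSet (a ∷ [])) a) ⟩
      termCoeff (1# , varMon (opposite x a) , Vec.replicate m false)
  oneEdgeStar-∝ x a inc ν T = begin
    coeff (starRep x (a ∷ [])) ν T               ≈⟨ starRep-coeff x (a ∷ []) (All.[] AP.∷ AP.[]) ν T ⟩
    wedgeSign (a ∷ []) * starCoeff x E ν T       ≈⟨ *-congˡ (sum-single a others≈0) ⟩
    wedgeSign (a ∷ []) * starSummand x E a ν T   ≈⟨ *-congˡ (starSummand-∈ x E a (edgeSet-∈ (a ∷ []) (here ≡.refl)) ν T) ⟩
    wedgeSign (a ∷ []) * (sgn (below E a) * termCoeff (1# , cofactor x a , E Vec.[ a ]≔ false) ν T)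
      ≡⟨ ≡.cong₂ (λ μ S → wedgeSign (a ∷ []) * (sgn (below E a) * termCoeff (1# , μ , S) ν T))
                 (cofactor-incident inc) (edgeSet-delete a [] λ ()) ⟩
    wedgeSign (a ∷ []) * (sgn (below E a) * termCoeff (1# , varMon (opposite x a) , Vec.replicate m false) ν T)
      ≈⟨ *-assoc _ _ _ ⟨
    (wedgeSign (a ∷ []) * sgn (below E a)) * termCoeff (1# , varMon (opposite x a) , Vec.replicate m false) ν T ∎
    where
    E = edgeSet (a ∷ [])
    others≈0 : ∀ j → j ≢ a → starSummand x E j ν T ≈ 0#
    others≈0 j j≢a rewrite edgeSet-∉ (a ∷ []) λ { (here j≡a) → j≢a j≡a } = refl

  oneEdgeStar-sign : ∀ a → IsSign (wedgeSign (a ∷ []) * sgn (below (edgeSet (a ∷ [])) a))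
  oneEdgeStar-sign a = isSign-* (wedgeSign-isSign (a ∷ [])) (sgn-isSign (below (edgeSet (a ∷ [])) a))

  oneEdgeDegree : ∀ x₀ h → Incident h x₀ → ∀ D → (∀ v → lookup D v ℕ.+ δ x₀ v ≡ edgeListExp (h ∷ []) v) →
                  ∀ v → lookup D v ≡ δ (opposite x₀ h) v
  oneEdgeDegree x₀ h inc₀ D D-exp v = NP.+-cancelʳ-≡ (δ x₀ v) _ _
    (≡.trans (D-exp v) (≡.trans (NP.+-identityʳ _) (≡.trans (edgeExp-incident inc₀ v) (NP.+-comm (δ x₀ v) _))))

  degreeVar⇒opposite : ∀ y₀ D → (∀ v → lookup D v ≡ δ y₀ v) → ∀ (τ : Star) → HasDeg (rep τ) D →
                       ∀ {a} → a ∈ Star.edges τ → opposite (Star.center τ) a ≡ y₀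
  degreeVar⇒opposite y₀ D D≡δ τ deg {a} a∈ = ≡.sym (δ-pos⇒≡ (≡.subst (1 ℕ.≤_) D-at-y (edgeListExp-opposite x _ (Star.incident τ) a∈)))
    where
    x = Star.center τ
    y = opposite x a
    D-at-y : edgeListExp (Star.edges τ) y ≡ δ y₀ y
    D-at-y = ≡.trans (≡.sym (rep-degree τ D deg y))
               (≡.trans (≡.cong (lookup D y ℕ.+_) (δ-≢ (opposite≢ (All.lookup (Star.incident τ) a∈) ∘ ≡.sym)))
                        (≡.trans (NP.+-identityʳ _) (D≡δ y)))

  sameDegree⇒HEq±-oneEdge : ∀ x₀ h → Incident h x₀ →
    ∀ D → (∀ v → lookup D v ℕ.+ δ x₀ v ≡ edgeListExp (h ∷ []) v) →
    ∀ (τ : Star) → HasDeg (rep τ) D → HEq± (rep τ) (starRep x₀ (h ∷ []))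
  sameDegree⇒HEq±-oneEdge x₀ h inc₀ D D-exp record { edges = [] ; nonempty = nonempty } _ = ⊥-elim (nonempty ≡.refl)
  sameDegree⇒HEq±-oneEdge x₀ h inc₀ D D-exp τ@(record { center = x ; edges = a ∷ [] ; incident = inc All.∷ _ }) deg =
    ∝⇒HEq± (rep τ) (starRep x₀ (h ∷ [])) (isSign-* (oneEdgeStar-sign a) (oneEdgeStar-sign h))
      (∝-trans {g = termCoeff (1# , varMon (opposite x₀ h) , Vec.replicate m false)}
        (≡.subst (λ y → coeff (rep τ) ∝⟨ _ ⟩ termCoeff (1# , varMon y , Vec.replicate m false)) same-opposite (oneEdgeStar-∝ x a inc))
        (∝-sym (oneEdgeStar-sign h) (oneEdgeStar-∝ x₀ h inc₀)))
    where
    same-opposite : opposite x a ≡ opposite x₀ h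
    same-opposite = degreeVar⇒opposite (opposite x₀ h) D (oneEdgeDegree x₀ h inc₀ D D-exp) τ deg (here ≡.refl)
  sameDegree⇒HEq±-oneEdge x₀ h inc₀ D D-exp τ@(record { center = x ; edges = a ∷ b ∷ t ; incident = incs }) deg =
    ⊥-elim (NP.1+n≰n (≡.subst (2 ℕ.≤_) length≡1 (ℕ.s≤s (ℕ.s≤s ℕ.z≤n))))
    where
    y₀≢x : opposite x₀ h ≢ x
    y₀≢x y₀≡x = opposite≢ (All.lookup incs (here ≡.refl))
                  (≡.trans (degreeVar⇒opposite (opposite x₀ h) D (oneEdgeDegree x₀ h inc₀ D D-exp) τ deg (here ≡.refl)) y₀≡x)
    length≡1 : List.length (a ∷ b ∷ t) ≡ 1
    length≡1 = ≡.trans (length≡centerExp+1 τ D deg)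
                 (≡.cong (ℕ._+ 1) (≡.trans (oneEdgeDegree x₀ h inc₀ D D-exp x) (δ-≢ y₀≢x)))

  centerExp≡0⇒degreeVar : ∀ (τ : Star) D → HasDeg (rep τ) D → lookup D (Star.center τ) ≡ 0 →
                          ∃[ y ] ∀ v → lookup D v ≡ δ y v
  centerExp≡0⇒degreeVar record { edges = [] ; nonempty = nonempty } _ _ _ = ⊥-elim (nonempty ≡.refl)
  centerExp≡0⇒degreeVar τ@(record { center = x ; edges = a ∷ [] ; incident = inc All.∷ _ }) D deg _ =
    opposite x a , oneEdgeDegree x a inc D (rep-degree τ D deg)
  centerExp≡0⇒degreeVar τ@(record { edges = a ∷ b ∷ t }) D deg D-x≡0 =
    ⊥-elim (NP.1+n≰n (≡.subst (2 ℕ.≤_) (≡.trans (length≡centerExp+1 τ D deg) (≡.cong (ℕ._+ 1) D-x≡0)) (ℕ.s≤s (ℕ.s≤s ℕ.z≤n))))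

  module Triangle (α β₁ β₂ : Fin s) (j₁ j₂ : Fin m) (J₁ : Joins j₁ α β₁) (J₂ : Joins j₂ α β₂) (β₁≢β₂ : β₁ ≢ β₂)
                  (D : Mon) (D≡ : ∀ v → lookup D v ≡ δ α v ℕ.+ δ β₁ v ℕ.+ δ β₂ v) where

    α≢β₁ : α ≢ β₁
    α≢β₁ = joins⇒≢ J₁

    α≢β₂ : α ≢ β₂
    α≢β₂ = joins⇒≢ J₂

    j₁≢j₂ : j₁ ≢ j₂
    j₁≢j₂ j₁≡j₂ = β₁≢β₂ (≡.trans (≡.sym (opposite-joins J₁)) (≡.trans (≡.cong (opposite α) j₁≡j₂) (opposite-joins J₂)))

    D-at : ∀ {v} → v ≡ α ⊎ v ≡ β₁ ⊎ v ≡ β₂ → lookup D v ≡ 1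
    D-at {v} (inj₁ ≡.refl) = ≡.trans (D≡ α) (≡.cong₂ ℕ._+_ (≡.cong₂ ℕ._+_ (δ-refl α) (δ-≢ (α≢β₁ ∘ ≡.sym))) (δ-≢ (α≢β₂ ∘ ≡.sym)))
    D-at {v} (inj₂ (inj₁ ≡.refl)) = ≡.trans (D≡ β₁) (≡.cong₂ ℕ._+_ (≡.cong₂ ℕ._+_ (δ-≢ α≢β₁) (δ-refl β₁)) (δ-≢ (β₁≢β₂ ∘ ≡.sym)))
    D-at {v} (inj₂ (inj₂ ≡.refl)) = ≡.trans (D≡ β₂) (≡.cong₂ ℕ._+_ (≡.cong₂ ℕ._+_ (δ-≢ α≢β₂) (δ-≢ β₁≢β₂)) (δ-refl β₂))

    l₀ : List (Fin m)
    l₀ = j₁ ∷ j₂ ∷ []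

    z₀ : Elem
    z₀ = starRep α l₀

    l₀-unique : Unique l₀
    l₀-unique = (j₁≢j₂ All.∷ All.[]) AP.∷ All.[] AP.∷ AP.[]

    l₀-incident : AllIncident α l₀
    l₀-incident = joins⇒incident J₁ All.∷ joins⇒incident J₂ All.∷ All.[]

    l₀-exp : ∀ v → lookup D v ℕ.+ δ α v ≡ edgeListExp l₀ v
    l₀-exp v = ≡.trans (≡.cong (ℕ._+ δ α v) (D≡ v))
      (≡.trans (rearrange (δ α v) (δ β₁ v) (δ β₂ v))
        (≡.sym (≡.cong₂ ℕ._+_ (edgeExp-joins J₁ v) (≡.cong (ℕ._+ 0) (edgeExp-joins J₂ v)))))
      where
      rearrange : ∀ a b c → a ℕ.+ b ℕ.+ c ℕ.+ a ≡ a ℕ.+ b ℕ.+ (a ℕ.+ c ℕ.+ 0)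
      rearrange = solve-∀

    T₁ T₂ : EdgeSet
    T₁ = edgeSet l₀ Vec.[ j₁ ]≔ false
    T₂ = edgeSet l₀ Vec.[ j₂ ]≔ false

    z₀-at-β₁ : ¬ (coeff z₀ (varMon β₁) T₁ ≈ 0#)
    z₀-at-β₁ = ≡.subst (λ μ → ¬ (coeff z₀ μ T₁ ≈ 0#))
      (≡.trans (cofactor-incident (joins⇒incident J₁)) (≡.cong varMon (opposite-joins J₁)))
      (starRep-coeff≉0 α l₀ l₀-unique (here ≡.refl))

    z₀-at-β₂ : ¬ (coeff z₀ (varMon β₂) T₂ ≈ 0#)
    z₀-at-β₂ = ≡.subst (λ μ → ¬ (coeff z₀ μ T₂ ≈ 0#))
      (≡.trans (cofactor-incident (joins⇒incident J₂)) (≡.cong varMon (opposite-joins J₂)))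
      (starRep-coeff≉0 α l₀ l₀-unique (there (here ≡.refl)))

    center-in-triangle : ∀ (τ : Star) → HasDeg (rep τ) D →
      Star.center τ ≡ α ⊎ Star.center τ ≡ β₁ ⊎ Star.center τ ≡ β₂
    center-in-triangle τ deg with Star.center τ Fin.≟ α | Star.center τ Fin.≟ β₁ | Star.center τ Fin.≟ β₂
    ... | yes x≡α | _        | _        = inj₁ x≡α
    ... | no _    | yes x≡β₁ | _        = inj₂ (inj₁ x≡β₁)
    ... | no _    | no _     | yes x≡β₂ = inj₂ (inj₂ x≡β₂)
    ... | no x≢α  | no x≢β₁  | no x≢β₂
      with centerExp≡0⇒degreeVar τ D deg
             (≡.trans (D≡ x) (≡.cong₂ ℕ._+_ (≡.cong₂ ℕ._+_ (δ-≢ (x≢α ∘ ≡.sym)) (δ-≢ (x≢β₁ ∘ ≡.sym))) (δ-≢ (x≢β₂ ∘ ≡.sym))))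
      where x = Star.center τ
    ...   | y , D≡δy = ⊥-elim (α≢β₁ (≡.trans (≡.sym (y≡ (inj₁ ≡.refl))) (y≡ (inj₂ (inj₁ ≡.refl)))))
      where
      y≡ : ∀ {v} → v ≡ α ⊎ v ≡ β₁ ⊎ v ≡ β₂ → y ≡ v
      y≡ {v} v∈ = δ-pos⇒≡ (NP.≤-reflexive (≡.trans (≡.sym (D-at v∈)) (D≡δy v)))

    module ThirdEdge (j₃ : Fin m) (J₃ : Joins j₃ β₁ β₂) where

      j₁≢j₃ : j₁ ≢ j₃
      j₁≢j₃ j₁≡j₃ = α≢β₂ (≡.trans (≡.sym (opposite-joins (joins-sym J₁))) (≡.trans (≡.cong (opposite β₁) j₁≡j₃) (opposite-joins J₃)))

      j₂≢j₃ : j₂ ≢ j₃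
      j₂≢j₃ j₂≡j₃ = α≢β₁ (≡.trans (≡.sym (opposite-joins (joins-sym J₂))) (≡.trans (≡.cong (opposite β₂) j₂≡j₃) (opposite-joins (joins-sym J₃))))

      l₁ l₂ : List (Fin m)
      l₁ = j₁ ∷ j₃ ∷ []
      l₂ = j₂ ∷ j₃ ∷ []

      z₁ z₂ : Elem
      z₁ = starRep β₁ l₁
      z₂ = starRep β₂ l₂

      l₁-unique : Unique l₁
      l₁-unique = (j₁≢j₃ All.∷ All.[]) AP.∷ All.[] AP.∷ AP.[]

      l₂-unique : Unique l₂
      l₂-unique = (j₂≢j₃ All.∷ All.[]) AP.∷ All.[] AP.∷ AP.[]

      l₁-incident : AllIncident β₁ l₁
      l₁-incident = joins⇒incident (joins-sym J₁) All.∷ joins⇒incident J₃ All.∷ All.[]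

      l₂-incident : AllIncident β₂ l₂
      l₂-incident = joins⇒incident (joins-sym J₂) All.∷ joins⇒incident (joins-sym J₃) All.∷ All.[]

      l₁-exp : ∀ v → lookup D v ℕ.+ δ β₁ v ≡ edgeListExp l₁ v
      l₁-exp v = ≡.trans (≡.cong (ℕ._+ δ β₁ v) (D≡ v)) (≡.trans (rearrange (δ α v) (δ β₁ v) (δ β₂ v))
                   (≡.sym (≡.cong₂ ℕ._+_ (edgeExp-joins J₁ v) (≡.cong (ℕ._+ 0) (edgeExp-joins J₃ v)))))
        where
        rearrange : ∀ a b c → a ℕ.+ b ℕ.+ c ℕ.+ b ≡ a ℕ.+ b ℕ.+ (b ℕ.+ c ℕ.+ 0)
        rearrange = solve-∀

      l₂-exp : ∀ v → lookup D v ℕ.+ δ β₂ v ≡ edgeListExp l₂ v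
      l₂-exp v = ≡.trans (≡.cong (ℕ._+ δ β₂ v) (D≡ v)) (≡.trans (rearrange (δ α v) (δ β₁ v) (δ β₂ v))
                   (≡.sym (≡.cong₂ ℕ._+_ (edgeExp-joins J₂ v) (≡.cong (ℕ._+ 0) (edgeExp-joins J₃ v)))))
        where
        rearrange : ∀ a b c → a ℕ.+ b ℕ.+ c ℕ.+ c ≡ a ℕ.+ c ℕ.+ (b ℕ.+ c ℕ.+ 0)
        rearrange = solve-∀

      E₀ E₁ E₂ : EdgeSet
      E₀ = edgeSet l₀
      E₁ = edgeSet l₁
      E₂ = edgeSet l₂

      starCoeff-triangle : ∀ ν T →
        starCoeff α E₀ ν T ≈ (sgn (below E₀ j₂) * sgn (below E₁ j₃)) * starCoeff β₁ E₁ ν T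
                           + (sgn (below E₀ j₁) * sgn (below E₂ j₃)) * starCoeff β₂ E₂ ν T
      starCoeff-triangle ν T = begin
        starCoeff α E₀ ν T
          ≈⟨ starCoeff-pair α J₁ J₂ j₁≢j₂ ν T ⟩
        sgn (below E₀ j₁) * X + sgn (below E₀ j₂) * Y
          ≈⟨ triangle-relation X Y Z (sgn-isSign (below E₀ j₂)) (sgn-isSign (below E₁ j₃)) (sgn-isSign (below E₂ j₃))
                               (sgn-pair j₁ j₂ j₁≢j₂) (sgn-pair j₁ j₃ j₁≢j₃) (sgn-pair j₂ j₃ j₂≢j₃) ⟩
        (sgn (below E₀ j₂) * sgn (below E₁ j₃)) * (sgn (below E₁ j₁) * Z + sgn (below E₁ j₃) * Y)
          + (sgn (below E₀ j₁) * sgn (below E₂ j₃)) * (sgn (below E₂ j₂) * Z + sgn (below E₂ j₃) * X)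
          ≈⟨ +-cong (*-congˡ (sym (starCoeff-pair β₁ (joins-sym J₁) J₃ j₁≢j₃ ν T)))
                    (*-congˡ (sym (starCoeff-pair β₂ (joins-sym J₂) (joins-sym J₃) j₂≢j₃ ν T))) ⟩
        (sgn (below E₀ j₂) * sgn (below E₁ j₃)) * starCoeff β₁ E₁ ν T
          + (sgn (below E₀ j₁) * sgn (below E₂ j₃)) * starCoeff β₂ E₂ ν T ∎
        where
        X = termCoeff (1# , varMon β₁ , edgeSet (j₂ ∷ [])) ν T
        Y = termCoeff (1# , varMon β₂ , edgeSet (j₁ ∷ [])) ν T
        Z = termCoeff (1# , varMon α , edgeSet (j₃ ∷ [])) ν T

      λ₁ λ₂ : Carrier
      λ₁ = (wedgeSign l₀ * (sgn (below E₀ j₂) * sgn (below E₁ j₃))) * wedgeSign l₁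
      λ₂ = (wedgeSign l₀ * (sgn (below E₀ j₁) * sgn (below E₂ j₃))) * wedgeSign l₂

      λ₁-isSign : IsSign λ₁
      λ₁-isSign = isSign-* (isSign-* (wedgeSign-isSign l₀) (isSign-* (sgn-isSign (below E₀ j₂)) (sgn-isSign (below E₁ j₃)))) (wedgeSign-isSign l₁)

      λ₂-isSign : IsSign λ₂
      λ₂-isSign = isSign-* (isSign-* (wedgeSign-isSign l₀) (isSign-* (sgn-isSign (below E₀ j₁)) (sgn-isSign (below E₂ j₃)))) (wedgeSign-isSign l₂)

      z₀-triangle : ∀ ν T → coeff z₀ ν T ≈ λ₁ * coeff z₁ ν T + λ₂ * coeff z₂ ν T
      z₀-triangle ν T = begin
        coeff z₀ ν T                                   ≈⟨ starRep-coeff α l₀ l₀-unique ν T ⟩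
        wedgeSign l₀ * starCoeff α E₀ ν T              ≈⟨ *-congˡ (starCoeff-triangle ν T) ⟩
        wedgeSign l₀ * (μ₁ * r₁ + μ₂ * r₂)             ≈⟨ distribˡ (wedgeSign l₀) _ _ ⟩
        wedgeSign l₀ * (μ₁ * r₁) + wedgeSign l₀ * (μ₂ * r₂)
                                                       ≈⟨ +-cong (sym (*-assoc _ _ _)) (sym (*-assoc _ _ _)) ⟩
        (wedgeSign l₀ * μ₁) * r₁ + (wedgeSign l₀ * μ₂) * r₂
                                                       ≈⟨ +-cong (*-congˡ (r₁≈ ν T)) (*-congˡ (r₂≈ ν T)) ⟩
        (wedgeSign l₀ * μ₁) * (wedgeSign l₁ * coeff z₁ ν T) + (wedgeSign l₀ * μ₂) * (wedgeSign l₂ * coeff z₂ ν T)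
                                                       ≈⟨ +-cong (sym (*-assoc _ _ _)) (sym (*-assoc _ _ _)) ⟩
        λ₁ * coeff z₁ ν T + λ₂ * coeff z₂ ν T          ∎
        where
        μ₁ = sgn (below E₀ j₂) * sgn (below E₁ j₃)
        μ₂ = sgn (below E₀ j₁) * sgn (below E₂ j₃)
        r₁ = starCoeff β₁ E₁ ν T
        r₂ = starCoeff β₂ E₂ ν T
        r₁≈ : starCoeff β₁ E₁ ∝⟨ wedgeSign l₁ ⟩ coeff z₁
        r₁≈ = ∝-sym (wedgeSign-isSign l₁) (starRep-coeff β₁ l₁ l₁-unique)
        r₂≈ : starCoeff β₂ E₂ ∝⟨ wedgeSign l₂ ⟩ coeff z₂
        r₂≈ = ∝-sym (wedgeSign-isSign l₂) (starRep-coeff β₂ l₂ l₂-unique)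

      module Converse (σ : Fin 2 → Star) (i₁ i₂ : Fin 2) (i₁≢i₂ : i₁ ≢ i₂)
                      (σ₁≈z₁ : HEq± (rep (σ i₁)) z₁) (σ₂≈z₂ : HEq± (rep (σ i₂)) z₂) where

        σ₁∝z₁ : ∃[ u ] IsSign u × coeff (rep (σ i₁)) ∝⟨ u ⟩ coeff z₁
        σ₁∝z₁ = HEq±⇒∝ (rep (σ i₁)) z₁ (rep-onVariables (σ i₁)) (starRep-onVariables β₁ l₁ l₁-unique l₁-incident) σ₁≈z₁

        σ₂∝z₂ : ∃[ u ] IsSign u × coeff (rep (σ i₂)) ∝⟨ u ⟩ coeff z₂
        σ₂∝z₂ = HEq±⇒∝ (rep (σ i₂)) z₂ (rep-onVariables (σ i₂)) (starRep-onVariables β₂ l₂ l₂-unique l₂-incident) σ₂≈z₂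

        u₁ u₂ : Carrier
        u₁ = proj₁ σ₁∝z₁
        u₂ = proj₁ σ₂∝z₂

        cf : Fin 2 → Carrier
        cf i = if does (i Fin.≟ i₁) then λ₁ * u₁ else λ₂ * u₂

        cf-i₁ : cf i₁ ≡ λ₁ * u₁
        cf-i₁ with i₁ Fin.≟ i₁
        ... | yes _    = ≡.refl
        ... | no i₁≢i₁ = ⊥-elim (i₁≢i₁ ≡.refl)

        cf-i₂ : cf i₂ ≡ λ₂ * u₂
        cf-i₂ with i₂ Fin.≟ i₁
        ... | yes i₂≡i₁ = ⊥-elim (i₁≢i₂ (≡.sym i₂≡i₁))
        ... | no _      = ≡.refl

        cf≉0 : ∀ i → ¬ (cf i ≈ 0#)
        cf≉0 i with Fin2-cover i₁ i₂ i₁≢i₂ i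
        ... | inj₁ ≡.refl = ≡.subst (λ a → ¬ (a ≈ 0#)) (≡.sym cf-i₁) (isSign⇒≉0 0≉1 (isSign-* λ₁-isSign (proj₁ (proj₂ σ₁∝z₁))))
        ... | inj₂ ≡.refl = ≡.subst (λ a → ¬ (a ≈ 0#)) (≡.sym cf-i₂) (isSign⇒≉0 0≉1 (isSign-* λ₂-isSign (proj₁ (proj₂ σ₂∝z₂))))

        lincomb-pair : ∀ b ν T → coeff (lincomb 2 b σ) ν T ≈ b i₁ * coeff (rep (σ i₁)) ν T + b i₂ * coeff (rep (σ i₂)) ν T
        lincomb-pair b ν T = trans (coeff-lincomb 2 b σ ν T)
          (sum-pair i₁ i₂ i₁≢i₂ λ i i≢i₁ i≢i₂ → ⊥-elim ([ i≢i₁ , i≢i₂ ]′ (Fin2-cover i₁ i₂ i₁≢i₂ i)))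

        z₀≋comb : z₀ ≋ lincomb 2 cf σ
        z₀≋comb ν T = begin
          coeff z₀ ν T
            ≈⟨ z₀-triangle ν T ⟩
          λ₁ * coeff z₁ ν T + λ₂ * coeff z₂ ν T
            ≈⟨ +-cong (sign-cancel-middle λ₁ (coeff z₁ ν T) (proj₁ (proj₂ σ₁∝z₁)))
                      (sign-cancel-middle λ₂ (coeff z₂ ν T) (proj₁ (proj₂ σ₂∝z₂))) ⟨
          (λ₁ * u₁) * (u₁ * coeff z₁ ν T) + (λ₂ * u₂) * (u₂ * coeff z₂ ν T)
            ≈⟨ +-cong (*-cong (reflexive cf-i₁) (proj₂ (proj₂ σ₁∝z₁) ν T)) (*-cong (reflexive cf-i₂) (proj₂ (proj₂ σ₂∝z₂) ν T)) ⟨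
          cf i₁ * coeff (rep (σ i₁)) ν T + cf i₂ * coeff (rep (σ i₂)) ν T
            ≈⟨ lincomb-pair cf ν T ⟨
          coeff (lincomb 2 cf σ) ν T ∎

        σ₁-at-β₁ : ∀ T → coeff (rep (σ i₁)) (varMon β₁) T ≈ 0#
        σ₁-at-β₁ T = trans (proj₂ (proj₂ σ₁∝z₁) (varMon β₁) T) (trans (*-congˡ (starRep-center β₁ l₁ l₁-unique l₁-incident T)) (zeroʳ _))

        σ₂-at-β₂ : ∀ T → coeff (rep (σ i₂)) (varMon β₂) T ≈ 0#
        σ₂-at-β₂ T = trans (proj₂ (proj₂ σ₂∝z₂) (varMon β₂) T) (trans (*-congˡ (starRep-center β₂ l₂ l₂-unique l₂-incident T)) (zeroʳ _))

        σ≁z₀ : ∀ i → ¬ HEq (rep (σ i)) z₀ × ¬ HEq (rep (σ i)) (neg z₀)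
        σ≁z₀ i with Fin2-cover i₁ i₂ i₁≢i₂ i
        ... | inj₁ ≡.refl = ¬HEq±-varMon (rep (σ i₁)) z₀ β₁ T₁ (σ₁-at-β₁ T₁) z₀-at-β₁
        ... | inj₂ ≡.refl = ¬HEq±-varMon (rep (σ i₂)) z₀ β₂ T₂ (σ₂-at-β₂ T₂) z₀-at-β₂

        σ-deg : ∀ i → HasDeg (rep (σ i)) D
        σ-deg i with Fin2-cover i₁ i₂ i₁≢i₂ i
        ... | inj₁ ≡.refl = HasDeg-∝ (rep (σ i₁)) z₁ (proj₂ (proj₂ σ₁∝z₁)) (starRep-hasDeg β₁ l₁ l₁-unique l₁-incident D l₁-exp)
        ... | inj₂ ≡.refl = HasDeg-∝ (rep (σ i₂)) z₂ (proj₂ (proj₂ σ₂∝z₂)) (starRep-hasDeg β₂ l₂ l₂-unique l₂-incident D l₂-exp)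

        pair-terms≈0 : ∀ (b : Fin 2 → Carrier) y T → b i₁ * coeff (rep (σ i₁)) (varMon y) T ≈ 0# → b i₂ * coeff (rep (σ i₂)) (varMon y) T ≈ 0# →
                       ∀ i → b i * coeff (rep (σ i)) (varMon y) T ≈ 0#
        pair-terms≈0 b y T term₁≈0 term₂≈0 i with Fin2-cover i₁ i₂ i₁≢i₂ i
        ... | inj₁ ≡.refl = term₁≈0
        ... | inj₂ ≡.refl = term₂≈0

        minimal : ∀ b → (∃[ i ] b i ≈ 0#) → ¬ HEq z₀ (lincomb 2 b σ)
        minimal b (i , bᵢ≈0) with Fin2-cover i₁ i₂ i₁≢i₂ i
        ... | inj₁ ≡.refl = ¬HEq-lincomb-varMon z₀ 2 b σ β₂ T₂ z₀-at-β₂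
                              (pair-terms≈0 b β₂ T₂ (trans (*-congʳ bᵢ≈0) (zeroˡ (coeff (rep (σ i)) (varMon β₂) T₂)))
                                                   (trans (*-congˡ (σ₂-at-β₂ T₂)) (zeroʳ (b i₂))))
        ... | inj₂ ≡.refl = ¬HEq-lincomb-varMon z₀ 2 b σ β₁ T₁ z₀-at-β₁
                              (pair-terms≈0 b β₁ T₁ (trans (*-congˡ (σ₁-at-β₁ T₁)) (zeroʳ (b i₁)))
                                                   (trans (*-congʳ bᵢ≈0) (zeroˡ (coeff (rep (σ i)) (varMon β₁) T₁))))

    module Forward {k} (σ : Fin k → Star) (cf : Fin k → Carrier)
                   (σ≁z₀ : ∀ i → ¬ HEq (rep (σ i)) z₀ × ¬ HEq (rep (σ i)) (neg z₀))
                   (σ-deg : ∀ i → HasDeg (rep (σ i)) D)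
                   (z₀≈comb : HEq z₀ (lincomb k cf σ))
                   (minimal : ∀ b → (∃[ i ] b i ≈ 0#) → ¬ HEq z₀ (lincomb k b σ)) where

      cen : Fin k → Fin s
      cen i = Star.center (σ i)

      cen-β : ∀ i → cen i ≡ β₁ ⊎ cen i ≡ β₂
      cen-β i with center-in-triangle (σ i) (σ-deg i)
      ... | inj₂ cen≡β = cen≡β
      ... | inj₁ cen≡α = ⊥-elim ([ proj₁ (σ≁z₀ i) , proj₂ (σ≁z₀ i) ]′
                                  (sameDegree⇒HEq± (σ i) l₀ l₀-unique l₀-incident D (σ-deg i) l₀-exp cen≡α))

      -- A star never involves its own centre variable, so ⋆₀'s term at t_{y′} needs a star centred at y.
      someCenter : ∀ y y′ T → (∀ i → cen i ≡ y ⊎ cen i ≡ y′) → ¬ (coeff z₀ (varMon y′) T ≈ 0#) → ∃[ i ] cen i ≡ y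
      someCenter y y′ T cover z₀≉0 with FinP.any? (λ i → cen i Fin.≟ y)
      ... | yes found = found
      ... | no none = ⊥-elim (¬HEq-lincomb-varMon z₀ k cf σ y′ T z₀≉0 term≈0 z₀≈comb)
        where
        term≈0 : ∀ i → cf i * coeff (rep (σ i)) (varMon y′) T ≈ 0#
        term≈0 i with cover i
        ... | inj₁ cen≡y  = ⊥-elim (none (i , cen≡y))
        ... | inj₂ cen≡y′ = trans (*-congˡ (≡.subst (λ x → coeff (rep (σ i)) (varMon x) T ≈ 0#) cen≡y′ (rep-center (σ i) T)))
                                  (zeroʳ _)

      thirdEdge : ∀ i → cen i ≡ β₁ → ∃[ j₃ ] Joins j₃ β₁ β₂
      thirdEdge i cen≡β₁ with edgeListExp-pos⇒joins β₁ (Star.edges (σ i)) β₂ incs (β₁≢β₂ ∘ ≡.sym) β₂-exp-pos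
        where
        incs = ≡.subst (λ x → AllIncident x (Star.edges (σ i))) cen≡β₁ (Star.incident (σ i))
        β₂-exp-pos : 1 ℕ.≤ edgeListExp (Star.edges (σ i)) β₂
        β₂-exp-pos = ≡.subst (1 ℕ.≤_) (rep-degree (σ i) D (σ-deg i) β₂)
                       (NP.≤-trans (NP.≤-reflexive (≡.sym (D-at (inj₂ (inj₂ ≡.refl))))) (NP.m≤m+n _ _))
      ... | j₃ , _ , J₃ = j₃ , J₃

      -- All stars centred at β₁ (resp. β₂) are multiples of z₁ (resp. z₂), so two coefficients suffice;
      -- minimality then leaves no room for a third index.
      module Reduce (i₁ i₂ : Fin k) (cen-i₁ : cen i₁ ≡ β₁) (cen-i₂ : cen i₂ ≡ β₂) (j₃ : Fin m) (J₃ : Joins j₃ β₁ β₂) where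
        open ThirdEdge j₃ J₃

        i₁≢i₂ : i₁ ≢ i₂
        i₁≢i₂ i₁≡i₂ = β₁≢β₂ (≡.trans (≡.sym cen-i₁) (≡.trans (≡.cong cen i₁≡i₂) cen-i₂))

        signAt : ∀ i → Dec (cen i ≡ β₁) → Carrier
        signAt i (yes _) = wedgeSign (Star.edges (σ i)) * wedgeSign l₁
        signAt i (no _)  = wedgeSign (Star.edges (σ i)) * wedgeSign l₂

        signAt-isSign : ∀ i d → IsSign (signAt i d)
        signAt-isSign i (yes _) = isSign-* (wedgeSign-isSign (Star.edges (σ i))) (wedgeSign-isSign l₁)
        signAt-isSign i (no _)  = isSign-* (wedgeSign-isSign (Star.edges (σ i))) (wedgeSign-isSign l₂)

        weightAt₁ weightAt₂ : (Fin k → Carrier) → ∀ i → Dec (cen i ≡ β₁) → Carrier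
        weightAt₁ b i d@(yes _) = b i * signAt i d
        weightAt₁ b i (no _)    = 0#
        weightAt₂ b i (yes _)   = 0#
        weightAt₂ b i d@(no _)  = b i * signAt i d

        weight₁ weight₂ : (Fin k → Carrier) → Fin k → Carrier
        weight₁ b i = weightAt₁ b i (cen i Fin.≟ β₁)
        weight₂ b i = weightAt₂ b i (cen i Fin.≟ β₁)

        term-split : ∀ b i ν T → b i * coeff (rep (σ i)) ν T ≈ weight₁ b i * coeff z₁ ν T + weight₂ b i * coeff z₂ ν T
        term-split b i ν T = split (cen i Fin.≟ β₁)
          where
          split : ∀ d → b i * coeff (rep (σ i)) ν T ≈ weightAt₁ b i d * coeff z₁ ν T + weightAt₂ b i d * coeff z₂ ν T
          split d@(yes cen≡β₁) = begin
            b i * coeff (rep (σ i)) ν T                             ≈⟨ *-congˡ (sameDegree⇒∝ (σ i) l₁ l₁-unique l₁-incident D (σ-deg i) l₁-exp cen≡β₁ ν T) ⟩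
            b i * (signAt i d * coeff z₁ ν T)                       ≈⟨ *-assoc _ _ _ ⟨
            b i * signAt i d * coeff z₁ ν T                         ≈⟨ +-identityʳ _ ⟨
            b i * signAt i d * coeff z₁ ν T + 0#                    ≈⟨ +-congˡ (zeroˡ _) ⟨
            b i * signAt i d * coeff z₁ ν T + 0# * coeff z₂ ν T     ∎
          split d@(no cen≢β₁) = begin
            b i * coeff (rep (σ i)) ν T                             ≈⟨ *-congˡ (sameDegree⇒∝ (σ i) l₂ l₂-unique l₂-incident D (σ-deg i) l₂-exp cen≡β₂ ν T) ⟩
            b i * (signAt i d * coeff z₂ ν T)                       ≈⟨ *-assoc _ _ _ ⟨
            b i * signAt i d * coeff z₂ ν T                         ≈⟨ +-identityˡ _ ⟨
            0# + b i * signAt i d * coeff z₂ ν T                    ≈⟨ +-congʳ (zeroˡ _) ⟨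
            0# * coeff z₁ ν T + b i * signAt i d * coeff z₂ ν T     ∎
            where cen≡β₂ = [ (λ cen≡β₁ → ⊥-elim (cen≢β₁ cen≡β₁)) , (λ cen≡β₂ → cen≡β₂) ]′ (cen-β i)

        lincomb-split : ∀ b ν T →
          coeff (lincomb k b σ) ν T ≈ sum (weight₁ b) * coeff z₁ ν T + sum (weight₂ b) * coeff z₂ ν T
        lincomb-split b ν T = begin
          coeff (lincomb k b σ) ν T
            ≈⟨ coeff-lincomb k b σ ν T ⟩
          sum (λ i → b i * coeff (rep (σ i)) ν T)
            ≈⟨ sum-cong-≋ (λ i → term-split b i ν T) ⟩
          sum (λ i → weight₁ b i * coeff z₁ ν T + weight₂ b i * coeff z₂ ν T)
            ≈⟨ ∑-distrib-+ (λ i → weight₁ b i * coeff z₁ ν T) (λ i → weight₂ b i * coeff z₂ ν T) ⟩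
          sum (λ i → weight₁ b i * coeff z₁ ν T) + sum (λ i → weight₂ b i * coeff z₂ ν T)
            ≈⟨ +-cong (sym (*-distribʳ-sum (coeff z₁ ν T) (weight₁ b))) (sym (*-distribʳ-sum (coeff z₂ ν T) (weight₂ b))) ⟩
          sum (weight₁ b) * coeff z₁ ν T + sum (weight₂ b) * coeff z₂ ν T ∎

        A B s₁ s₂ : Carrier
        A  = sum (weight₁ cf)
        B  = sum (weight₂ cf)
        s₁ = wedgeSign (Star.edges (σ i₁)) * wedgeSign l₁
        s₂ = wedgeSign (Star.edges (σ i₂)) * wedgeSign l₂

        reduced : Fin k → Carrier
        reduced i = if does (i Fin.≟ i₁) then A * s₁ else if does (i Fin.≟ i₂) then B * s₂ else 0#

        reduced-i₁ : reduced i₁ ≡ A * s₁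
        reduced-i₁ with i₁ Fin.≟ i₁
        ... | yes _     = ≡.refl
        ... | no i₁≢i₁  = ⊥-elim (i₁≢i₁ ≡.refl)

        reduced-i₂ : reduced i₂ ≡ B * s₂
        reduced-i₂ with i₂ Fin.≟ i₁ | i₂ Fin.≟ i₂
        ... | yes i₂≡i₁ | _        = ⊥-elim (i₁≢i₂ (≡.sym i₂≡i₁))
        ... | no _      | yes _    = ≡.refl
        ... | no _      | no i₂≢i₂ = ⊥-elim (i₂≢i₂ ≡.refl)

        reduced-other : ∀ {i} → i ≢ i₁ → i ≢ i₂ → reduced i ≡ 0#
        reduced-other {i} i≢i₁ i≢i₂ with i Fin.≟ i₁ | i Fin.≟ i₂
        ... | yes i≡i₁ | _        = ⊥-elim (i≢i₁ i≡i₁)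
        ... | no _     | yes i≡i₂ = ⊥-elim (i≢i₂ i≡i₂)
        ... | no _     | no _     = ≡.refl

        weight₁-reduced : sum (weight₁ reduced) ≈ A
        weight₁-reduced = trans (sum-single i₁ (λ i i≢i₁ → others i≢i₁ (cen i Fin.≟ β₁))) (at-i₁ (cen i₁ Fin.≟ β₁))
          where
          at-i₁ : ∀ d → weightAt₁ reduced i₁ d ≈ A
          at-i₁ (yes _)     = trans (*-congʳ (reflexive reduced-i₁)) (sign-cancelʳ A (signAt-isSign i₁ (yes cen-i₁)))
          at-i₁ (no cen≢β₁) = ⊥-elim (cen≢β₁ cen-i₁)
          others : ∀ {i} → i ≢ i₁ → ∀ d → weightAt₁ reduced i d ≈ 0#
          others {i} i≢i₁ (yes cen≡β₁) = trans (*-congʳ (reflexive (reduced-other i≢i₁ i≢i₂))) (zeroˡ _)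
            where i≢i₂ = λ i≡i₂ → β₁≢β₂ (≡.trans (≡.sym cen≡β₁) (≡.trans (≡.cong cen i≡i₂) cen-i₂))
          others i≢i₁ (no _) = refl

        weight₂-reduced : sum (weight₂ reduced) ≈ B
        weight₂-reduced = trans (sum-single i₂ (λ i i≢i₂ → others i≢i₂ (cen i Fin.≟ β₁))) (at-i₂ (cen i₂ Fin.≟ β₁))
          where
          at-i₂ : ∀ d → weightAt₂ reduced i₂ d ≈ B
          at-i₂ (yes cen≡β₁) = ⊥-elim (β₁≢β₂ (≡.trans (≡.sym cen≡β₁) cen-i₂))
          at-i₂ (no cen≢β₁)  = trans (*-congʳ (reflexive reduced-i₂)) (sign-cancelʳ B (signAt-isSign i₂ (no cen≢β₁)))
          others : ∀ {i} → i ≢ i₂ → ∀ d → weightAt₂ reduced i d ≈ 0#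
          others i≢i₂ (yes _) = refl
          others {i} i≢i₂ (no cen≢β₁) = trans (*-congʳ (reflexive (reduced-other i≢i₁ i≢i₂))) (zeroˡ _)
            where i≢i₁ = λ i≡i₁ → cen≢β₁ (≡.trans (≡.cong cen i≡i₁) cen-i₁)

        comb≋reduced : lincomb k cf σ ≋ lincomb k reduced σ
        comb≋reduced ν T = trans (lincomb-split cf ν T)
          (sym (trans (lincomb-split reduced ν T) (+-cong (*-congʳ weight₁-reduced) (*-congʳ weight₂-reduced))))

        k≡2 : k ≡ 2
        k≡2 = coveredByTwo⇒≡2 i₁ i₂ i₁≢i₂ λ i i≢i₁ i≢i₂ →
          minimal reduced (i , reflexive (reduced-other i≢i₁ i≢i₂)) (HEq-respʳ-≋ z₀ _ _ comb≋reduced z₀≈comb)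

      shape : (k ≡ 2) × ∃[ j₃ ] Joins j₃ β₁ β₂ × ∃[ i₁ ] ∃[ i₂ ]
                (i₁ ≢ i₂ × HEq± (rep (σ i₁)) (starRep β₁ (j₁ ∷ j₃ ∷ [])) × HEq± (rep (σ i₂)) (starRep β₂ (j₂ ∷ j₃ ∷ [])))
      shape with someCenter β₁ β₂ T₂ cen-β z₀-at-β₂ | someCenter β₂ β₁ T₁ (Sum.swap ∘ cen-β) z₀-at-β₁
      ... | i₁ , cen-i₁ | i₂ , cen-i₂ with thirdEdge i₁ cen-i₁
      ...   | j₃ , J₃ = k≡2 , j₃ , J₃ , i₁ , i₂ , i₁≢i₂
                      , sameDegree⇒HEq± (σ i₁) l₁ l₁-unique l₁-incident D (σ-deg i₁) l₁-exp cen-i₁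
                      , sameDegree⇒HEq± (σ i₂) l₂ l₂-unique l₂-incident D (σ-deg i₂) l₂-exp cen-i₂
        where open Reduce i₁ i₂ cen-i₁ cen-i₂ j₃ J₃
              open ThirdEdge j₃ J₃

  minDep⇒shape : ∀ σ₀ k σ cf → MinDep σ₀ k σ cf → Shape σ₀ k σ
  minDep⇒shape σ₀ zero σ cf (() , _)
  minDep⇒shape record { edges = [] ; nonempty = nonempty } (suc k) σ cf _ = ⊥-elim (nonempty ≡.refl)
  minDep⇒shape σ₀@(record { center = x₀ ; edges = h ∷ [] ; incident = inc All.∷ _ })
               (suc k) σ cf (_ , σ≁σ₀ , (D , σ₀-deg , σ-deg) , _) =
    ⊥-elim ([ proj₁ (σ≁σ₀ zero) , proj₂ (σ≁σ₀ zero) ]′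
      (sameDegree⇒HEq±-oneEdge x₀ h inc D (rep-degree σ₀ D σ₀-deg) (σ zero) (σ-deg zero)))
  minDep⇒shape σ₀@(record { center = x₀ ; edges = js@(_ ∷ _ ∷ _ ∷ _) ; incident = incs ; distinct = js! })
               (suc k) σ cf (_ , σ≁σ₀ , (D , σ₀-deg , σ-deg) , _) =
    ⊥-elim ([ proj₁ (σ≁σ₀ zero) , proj₂ (σ≁σ₀ zero) ]′
      (sameDegree⇒HEq±-manyEdges x₀ js js! incs (ℕ.s≤s (ℕ.s≤s (ℕ.s≤s ℕ.z≤n))) D (rep-degree σ₀ D σ₀-deg) (σ zero) (σ-deg zero)))
  minDep⇒shape σ₀@(record { center = α ; edges = j₁ ∷ j₂ ∷ [] ; incident = inc₁ All.∷ inc₂ All.∷ All.[]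
                          ; distinct = (j₁≢j₂ All.∷ All.[]) AP.∷ _ })
               (suc k) σ cf (_ , σ≁σ₀ , (D , σ₀-deg , σ-deg) , _ , σ₀≈comb , minimal) =
    let k≡2 , j₃ , J₃ , pair = Fwd.shape
    in  k≡2 , α , β₁ , β₂ , j₁ , j₂ , j₃ , J₁ , J₂ , J₃ , ≡.refl , ≡.refl , pair
    where
    β₁ = opposite α j₁
    β₂ = opposite α j₂
    J₁ = incident⇒joins inc₁
    J₂ = incident⇒joins inc₂
    β₁≢β₂ : β₁ ≢ β₂
    β₁≢β₂ β₁≡β₂ = j₁≢j₂ (joins-unique J₁ (≡.subst (Joins j₂ α) (≡.sym β₁≡β₂) J₂))
    D≡ : ∀ v → lookup D v ≡ δ α v ℕ.+ δ β₁ v ℕ.+ δ β₂ v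
    D≡ v = NP.+-cancelʳ-≡ (δ α v) _ _ (≡.trans (rep-degree σ₀ D σ₀-deg v)
             (≡.trans (≡.cong₂ ℕ._+_ (edgeExp-joins J₁ v) (≡.cong (ℕ._+ 0) (edgeExp-joins J₂ v)))
                      (rearrange (δ α v) (δ β₁ v) (δ β₂ v))))
      where
      rearrange : ∀ a b c → a ℕ.+ b ℕ.+ (a ℕ.+ c ℕ.+ 0) ≡ a ℕ.+ b ℕ.+ c ℕ.+ a
      rearrange = solve-∀
    module Fwd = Triangle.Forward α β₁ β₂ j₁ j₂ J₁ J₂ β₁≢β₂ D D≡ σ cf σ≁σ₀ σ-deg σ₀≈comb minimal

  shape⇒minDep : ∀ σ₀ k σ → Shape σ₀ k σ → ∃[ cf ] MinDep σ₀ k σ cf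
  shape⇒minDep record { center = α ; edges = j₁ ∷ j₂ ∷ [] } 2 σ
               (≡.refl , α , β₁ , β₂ , j₁ , j₂ , j₃ , J₁ , J₂ , J₃ , ≡.refl , ≡.refl , i₁ , i₂ , i₁≢i₂ , σ₁≈z₁ , σ₂≈z₂) =
    C.cf , ℕ.s≤s ℕ.z≤n , C.σ≁z₀ , (D , starRep-hasDeg α T.l₀ T.l₀-unique T.l₀-incident D T.l₀-exp , C.σ-deg)
         , C.cf≉0 , ≋⇒HEq T.z₀ (lincomb 2 C.cf σ) C.z₀≋comb , C.minimal
    where
    D : Mon
    D = Vec.tabulate (λ v → δ α v ℕ.+ δ β₁ v ℕ.+ δ β₂ v)
    module T = Triangle α β₁ β₂ j₁ j₂ J₁ J₂ (joins⇒≢ J₃) D (λ v → VecP.lookup∘tabulate _ v)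
    module C = T.ThirdEdge.Converse j₃ J₃ σ i₁ i₂ i₁≢i₂ σ₁≈z₁ σ₂≈z₂

lemma34 : ∀ {c ℓ : Level} (F : Field c ℓ) (Γ : Graph)
            (σ₀ : Koszul.Star F Γ) (k : ℕ) (σ : Fin k → Koszul.Star F Γ)
          → ((cf : Fin k → Field.Carrier F) → Koszul.MinDep F Γ σ₀ k σ cf → Koszul.Shape F Γ σ₀ k σ)
            × (Koszul.Shape F Γ σ₀ k σ → ∃[ cf ] Koszul.MinDep F Γ σ₀ k σ cf)
lemma34 F Γ σ₀ k σ = StarRelations.minDep⇒shape F Γ σ₀ k σ , StarRelations.shape⇒minDep F Γ σ₀ k σ
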